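{- The inhabitation problem for rank two intersection types is decidable: there is an algorithm which, given an intersection type $\tau$ with $\mathrm{rank}(\tau)\le 2$, decides whether there exists a closed $\lambda$-term $M$ such that $\emptyset \vdash M : \tau$ is derivable in the intersection type system described in the context.
   Context: Types are built from type variables by $\alpha\to\beta$ and $\alpha\cap\beta$; the operator $\cap$ is taken to be associative, commutative and idempotent. Environments $\Gamma$ are finite sets of declarations $x:\sigma$. The typing rules are: (VAR) $\Gamma\vdash x:\sigma$ if $(x:\sigma)\in\Gamma$; $(E\to)$ from $\Gamma\vdash M:\alpha\to\beta$ and $\Gamma\vdash N:\alpha$ infer $\Gamma\vdash MN:\beta$; $(I\to)$ from $\Gamma,(x:\alpha)\vdash M:\beta$ infer $\Gamma\vdash\lambda x.M:\alpha\to\beta$; $(E\cap)$ from $\Gamma\vdash M:\alpha\cap\beta$ infer $\Gamma\vdash M:\alpha$ and $\Gamma\vdash M:\beta$; $(I\cap)$ from $\Gamma\vdash M:\alpha$ and $\Gamma\vdash M:\beta$ infer $\Gamma\vdash M:\alpha\cap\beta$. The rank of a type is defined by: $\mathrm{rank}(\tau)=0$ if $\tau$ contains no $\cap$; $\mathrm{rank}(\tau\cap\sigma)=\max(1,\mathrm{rank}(\tau),\mathrm{rank}(\sigma))$; $\mathrm{rank}(\tau\to\sigma)=\max(1+\mathrm{rank}(\tau),\mathrm{rank}(\sigma))$ when $\mathrm{rank}(\tau)>0$ or $\mathrm{rank}(\sigma)>0$. The inhabitation problem asks, for a given type $\tau$, whether there is a closed term $M$ with $\emptyset\vdash M:\tau$.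 -}

module Defs where

open import Data.Nat using (ℕ; zero; suc; _⊔_)
open import Data.Fin using (Fin; zero; suc)
open import Data.List using (List; []; _∷_)
open import Data.Vec using (Vec; []; _∷_; lookup)
open import Data.Product using (∃)

infixr 7 _⇒_
infixr 8 _∩_
data Ty : Set where
  tv  : ℕ → Ty
  _⇒_ : Ty → Ty → Ty
  _∩_ : Ty → Ty → Ty

infix 4 _≈_
data _≈_ : Ty → Ty → Set where
  ≈-refl  : ∀ {a} → a ≈ a
  ≈-sym   : ∀ {a b} → a ≈ b → b ≈ a
  ≈-trans : ∀ {a b c} → a ≈ b → b ≈ c → a ≈ c
  ∩-assoc : ∀ {a b c} → (a ∩ b) ∩ c ≈ a ∩ (b ∩ c)
  ∩-comm  : ∀ {a b} → a ∩ b ≈ b ∩ a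
  ∩-idem  : ∀ {a} → a ∩ a ≈ a
  ⇒-cong  : ∀ {a a′ b b′} → a ≈ a′ → b ≈ b′ → a ⇒ b ≈ a′ ⇒ b′
  ∩-cong  : ∀ {a a′ b b′} → a ≈ a′ → b ≈ b′ → a ∩ b ≈ a′ ∩ b′

rank : Ty → ℕ
rank (tv _)  = 0
rank (a ∩ b) = 1 ⊔ (rank a ⊔ rank b)
rank (a ⇒ b) = rank⇒ (rank a) (rank b)
  where
  rank⇒ : ℕ → ℕ → ℕ
  rank⇒ zero zero = zero
  rank⇒ ra   rb   = suc ra ⊔ rb

data Tm (n : ℕ) : Set where
  var : Fin n → Tm n
  app : Tm n → Tm n → Tm n
  lam : Tm (suc n) → Tm n

Env : ℕ → Set
Env n = Vec Ty n

infix 3 _⊢_∶_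
data _⊢_∶_ {n : ℕ} (Γ : Env n) : Tm n → Ty → Set where
  VAR : ∀ x → Γ ⊢ var x ∶ lookup Γ x
  E⇒  : ∀ {M N a b} → Γ ⊢ M ∶ a ⇒ b → Γ ⊢ N ∶ a → Γ ⊢ app M N ∶ b
  I⇒  : ∀ {M a b} → (a ∷ Γ) ⊢ M ∶ b → Γ ⊢ lam M ∶ a ⇒ b
  E∩₁ : ∀ {M a b} → Γ ⊢ M ∶ a ∩ b → Γ ⊢ M ∶ a
  E∩₂ : ∀ {M a b} → Γ ⊢ M ∶ a ∩ b → Γ ⊢ M ∶ b
  I∩  : ∀ {M a b} → Γ ⊢ M ∶ a → Γ ⊢ M ∶ b → Γ ⊢ M ∶ a ∩ b
  ≈-ty : ∀ {M a b} → Γ ⊢ M ∶ a → a ≈ b → Γ ⊢ M ∶ b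

Inhabited : Ty → Set
Inhabited τ = ∃ λ (M : Tm 0) → [] ⊢ M ∶ τ

-- Typable terms are weakly normalising (by reducibility), so τ is inhabited iff it has a
-- closed normal inhabitant: a λ-prefix followed by a head variable applied to normal
-- arguments.  While the target has rank 2, the λ-prefix is forced by the arrow components
-- of the targets.  Once the head variable is chosen, every environment has rank ≤ 1 and
-- every argument has a target of rank 0, so intersections only occur in environments and
-- the term must solve finitely many such problems at once.  The search then runs over
-- states made of profiles (one type per problem), all built from subterms of τ; since it
-- depends only on the set of profiles of the variables in scope, there are finitely many
-- states up to equivalence, and the least fixed point of the search is reached after a
-- bounded number of iterations.

module Submission where

open import Defs
open import Data.Bool using (Bool; true; false; T; _∨_; if_then_else_)
open import Data.Bool.Properties using (T?; T-∨)
import Data.Nat as ℕ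
open import Data.Nat using (ℕ; zero; suc; _+_; _≤_; _<_; _⊔_; z≤n; s≤s; s≤s⁻¹)
open import Data.Nat.Properties using (≤-refl; ≤-trans; m≤n⇒m≤1+n; n≤1+n; m≤m+n; m≤n+m; m≤m⊔n; m≤n⊔m; n≮n)
open import Data.Fin using (Fin; zero; suc)
open import Data.List using (List; []; _∷_; _++_; _∷ʳ_; length; map; filter; foldl; concatMap; tabulate; cartesianProductWith)
open import Data.List.Properties using (foldl-∷ʳ; tabulate-cong)
open import Data.List.Membership.Propositional using (_∈_; find; lose)
open import Data.List.Membership.Propositional.Properties
  using (∈-++⁺ˡ; ∈-++⁺ʳ; ∈-++⁻; ∈-map⁺; ∈-map⁻; ∈-filter⁺; ∈-filter⁻; ∈-concatMap⁺; ∈-concatMap⁻;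
         ∈-tabulate⁺; ∈-tabulate⁻; ∈-cartesianProductWith⁺; ∈-cartesianProductWith⁻)
import Data.List.Membership.DecPropositional as DecMembership
open import Data.List.Relation.Binary.Subset.Propositional using (_⊆_)
open import Data.List.Relation.Binary.Subset.Propositional.Properties using (∷⁺ʳ)
open import Data.List.Relation.Binary.Pointwise using ([]; _∷_; ++⁺) renaming (Pointwise to Pointwiseᴸ)
open import Data.List.Relation.Unary.All using ([]; _∷_) renaming (All to Allᴸ; lookup to lookupᴸ)
open import Data.List.Relation.Unary.All.Properties using (∷ʳ⁺; tabulate⁺)
open import Data.List.Relation.Unary.Any using (here; there; any?)
open import Data.Maybe using (Maybe; just; nothing; maybe′)
import Data.Maybe as Maybe
open import Data.Vec using (Vec; []; _∷_; lookup; zipWith)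
import Data.Vec as Vec
open import Data.Vec.Properties using (≡-dec)
open import Data.Vec.Relation.Unary.All as All using (All; []; _∷_)
open import Data.Vec.Relation.Unary.All.Properties using (map⁺; lookup⁺)
open import Data.Vec.Relation.Binary.Pointwise.Inductive as Pointwise using (Pointwise; []; _∷_)
open import Data.Product using (∃; ∃₂; _×_; _,_; proj₁; proj₂; uncurry; swap)
open import Data.Sum using (_⊎_; inj₁; inj₂; [_,_]′)
open import Data.Unit using (⊤; tt)
open import Data.Empty using (⊥-elim)
open import Function using (_∘_)
open import Function.Bundles using (_⇔_; Equivalence; mk⇔)
open import Relation.Nullary using (Dec; yes; no; ¬_)
open import Relation.Nullary.Decidable using (⌊_⌋; map′; _×-dec_; _⊎-dec_; ¬?; toWitness; fromWitness)
open import Relation.Binary.Definitions using (DecidableEquality)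
open import Relation.Binary.PropositionalEquality using (_≡_; _≢_; refl; sym; trans; cong; cong₂; subst)

-- Least fixed points of monotone operators on finite sets of states

module Iteration {S : Set} (F : (S → Bool) → S → Bool) where

  iterate : ℕ → S → Bool
  iterate zero    _ = false
  iterate (suc i)   = F (iterate i)

  infix 4 _⇒[_]_
  _⇒[_]_ : (S → Bool) → (S → Set) → (S → Bool) → Set
  W ⇒[ G ] W′ = ∀ {s} → G s → T (W s) → T (W′ s)

  MonotoneOn : (S → Set) → Set
  MonotoneOn G = ∀ {W W′} → W ⇒[ G ] W′ → F W ⇒[ G ] F W′

  iterate-mono : ∀ {G i j} → MonotoneOn G → i ≤ j → iterate i ⇒[ G ] iterate j
  iterate-mono mono z≤n      _ ()
  iterate-mono mono (s≤s i≤j) = mono (iterate-mono mono i≤j)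

  Stable : (S → Set) → ℕ → Set
  Stable G j = iterate (suc j) ⇒[ G ] iterate j

  stable-collapse : ∀ {G j} → MonotoneOn G → Stable G j → ∀ d → iterate (d + j) ⇒[ G ] iterate j
  stable-collapse {G} {j} mono st = collapse
    where
    stable-above : ∀ d → Stable G (d + j)
    stable-above zero    = st
    stable-above (suc d) = mono (stable-above d)

    collapse : ∀ d → iterate (d + j) ⇒[ G ] iterate j
    collapse zero    g u = u
    collapse (suc d) g u = collapse d g (stable-above d g u)

  count : (S → Bool) → List S → ℕ
  count W []      = 0
  count W (s ∷ L) = if W s then suc (count W L) else count W L

  count-≤-length : ∀ W L → count W L ≤ length L
  count-≤-length W []      = z≤n
  count-≤-length W (s ∷ L) with W s
  ... | true  = s≤s (count-≤-length W L)
  ... | false = m≤n⇒m≤1+n (count-≤-length W L)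

  count-mono : ∀ {W W′} L → W ⇒[ _∈ L ] W′ → count W L ≤ count W′ L
  count-mono []      W⇒W′ = z≤n
  count-mono {W} {W′} (s ∷ L) W⇒W′ with W s | W′ s | W⇒W′ (here refl)
  ... | true  | true  | _ = s≤s (count-mono L λ s∈ → W⇒W′ (there s∈))
  ... | true  | false | f = ⊥-elim (f tt)
  ... | false | true  | _ = m≤n⇒m≤1+n (count-mono L λ s∈ → W⇒W′ (there s∈))
  ... | false | false | _ = count-mono L λ s∈ → W⇒W′ (there s∈)

  count-strict : ∀ {W W′ s} L → W ⇒[ _∈ L ] W′ → s ∈ L → T (W′ s) → ¬ T (W s) → count W L < count W′ L
  count-strict {W} {W′} (s ∷ L) W⇒W′ (here refl) u ¬v with W s | W′ s
  ... | true  | _     = ⊥-elim (¬v tt)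
  ... | false | false = ⊥-elim u
  ... | false | true  = s≤s (count-mono L λ s∈ → W⇒W′ (there s∈))
  count-strict {W} {W′} (s′ ∷ L) W⇒W′ (there s∈) u ¬v with W s′ | W′ s′ | W⇒W′ (here refl)
  ... | true  | true  | _ = s≤s (count-strict L (λ s∈ → W⇒W′ (there s∈)) s∈ u ¬v)
  ... | true  | false | f = ⊥-elim (f tt)
  ... | false | true  | _ = m≤n⇒m≤1+n (count-strict L (λ s∈ → W⇒W′ (there s∈)) s∈ u ¬v)
  ... | false | false | _ = count-strict L (λ s∈ → W⇒W′ (there s∈)) s∈ u ¬v

  _∼_ : S → S → Set
  s ∼ s′ = ∀ i → T (iterate i s) ⇔ T (iterate i s′)

  module _ (L : List S) (mono : MonotoneOn (λ _ → ⊤)) where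

    stable? : ∀ i → Stable (_∈ L) i ⊎ ∃ λ s → s ∈ L × T (iterate (suc i) s) × ¬ T (iterate i s)
    stable? i with any? (λ s → T? (iterate (suc i) s) ×-dec ¬? (T? (iterate i s))) L
    ... | yes growth = inj₂ (find growth)
    ... | no ¬growth = inj₁ stable
      where
      stable : Stable (_∈ L) i
      stable {s} s∈ u with T? (iterate i s)
      ... | yes v = v
      ... | no ¬v = ⊥-elim (¬growth (lose s∈ (u , ¬v)))

    -- Each unstable step makes one more state of L true.
    stable-or-growing : ∀ i → (∃ λ j → j ≤ i × Stable (_∈ L) j) ⊎ i ≤ count (iterate i) L
    stable-or-growing zero = inj₂ z≤n
    stable-or-growing (suc i) with stable-or-growing i
    ... | inj₁ (j , j≤i , st) = inj₁ (j , m≤n⇒m≤1+n j≤i , st)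
    ... | inj₂ i≤count with stable? i
    ... | inj₁ st                = inj₁ (i , n≤1+n i , st)
    ... | inj₂ (s , s∈ , u , ¬v) =
      inj₂ (≤-trans (s≤s i≤count) (count-strict L (λ _ → iterate-mono mono (n≤1+n i) tt) s∈ u ¬v))

    stable-within : ∃ λ j → j ≤ suc (length L) × Stable (_∈ L) j
    stable-within with stable-or-growing (suc (length L))
    ... | inj₁ found   = found
    ... | inj₂ K≤count = ⊥-elim (n≮n _ (≤-trans K≤count (count-≤-length _ L)))

    stabilise : ∀ {G} → MonotoneOn G → (∀ {s} → G s → ∃ λ s′ → s′ ∈ L × s ∼ s′) →
                ∀ {s} → G s → ∀ i → T (iterate i s) → T (iterate (suc (length L)) s)
    stabilise {G} monoG represent g i u with stable-within
    ... | j , j≤K , st =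
      iterate-mono monoG j≤K g (stable-collapse monoG stableG i g (iterate-mono monoG (m≤m+n i j) g u))
      where
      stableG : Stable G j
      stableG g′ v with represent g′
      ... | s′ , s′∈ , s∼s′ = Equivalence.from (s∼s′ j) (st s′∈ (Equivalence.to (s∼s′ (suc j)) v))

-- Types up to associativity, commutativity and idempotence of ∩

infix 4 _≟ᵀ_
_≟ᵀ_ : DecidableEquality Ty
tv i  ≟ᵀ tv j  = map′ (cong tv) (λ { refl → refl }) (i ℕ.≟ j)
a ⇒ b ≟ᵀ c ⇒ d = map′ (uncurry (cong₂ _⇒_)) (λ { refl → refl , refl }) (a ≟ᵀ c ×-dec b ≟ᵀ d)
a ∩ b ≟ᵀ c ∩ d = map′ (uncurry (cong₂ _∩_)) (λ { refl → refl , refl }) (a ≟ᵀ c ×-dec b ≟ᵀ d)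
tv _  ≟ᵀ _ ⇒ _ = no λ ()
tv _  ≟ᵀ _ ∩ _ = no λ ()
_ ⇒ _ ≟ᵀ tv _  = no λ ()
_ ⇒ _ ≟ᵀ _ ∩ _ = no λ ()
_ ∩ _ ≟ᵀ tv _  = no λ ()
_ ∩ _ ≟ᵀ _ ⇒ _ = no λ ()

data NonIntersection : Ty → Set where
  ni-tv : ∀ {i} → NonIntersection (tv i)
  ni-⇒  : ∀ {a b} → NonIntersection (a ⇒ b)

infix 4 _∈ᶜ_

data _∈ᶜ_ : Ty → Ty → Set where
  self : ∀ {c} → NonIntersection c → c ∈ᶜ c
  ∩ˡ   : ∀ {c a b} → c ∈ᶜ a → c ∈ᶜ a ∩ b
  ∩ʳ   : ∀ {c a b} → c ∈ᶜ b → c ∈ᶜ a ∩ b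

∈ᶜ-nonIntersection : ∀ {c A} → c ∈ᶜ A → NonIntersection c
∈ᶜ-nonIntersection (self nc) = nc
∈ᶜ-nonIntersection (∩ˡ c∈)   = ∈ᶜ-nonIntersection c∈
∈ᶜ-nonIntersection (∩ʳ c∈)   = ∈ᶜ-nonIntersection c∈

components : Ty → List Ty
components (tv i)  = tv i ∷ []
components (a ⇒ b) = a ⇒ b ∷ []
components (a ∩ b) = components a ++ components b

∈-components⁺ : ∀ {c A} → c ∈ᶜ A → c ∈ components A
∈-components⁺ (self ni-tv)     = here refl
∈-components⁺ (self ni-⇒)      = here refl
∈-components⁺ (∩ˡ c∈)          = ∈-++⁺ˡ (∈-components⁺ c∈)
∈-components⁺ (∩ʳ {a = a} c∈)  = ∈-++⁺ʳ (components a) (∈-components⁺ c∈)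

∈-components⁻ : ∀ A {c} → c ∈ components A → c ∈ᶜ A
∈-components⁻ (tv i)  (here refl) = self ni-tv
∈-components⁻ (a ⇒ b) (here refl) = self ni-⇒
∈-components⁻ (a ∩ b) c∈ = [ ∩ˡ ∘ ∈-components⁻ a , ∩ʳ ∘ ∈-components⁻ b ]′ (∈-++⁻ (components a) c∈)

infix 4 _≋_ _∈≋_ _⊆ᶜ_

data _≋_ : Ty → Ty → Set where
  ≋-tv : ∀ {i} → tv i ≋ tv i
  ≋-⇒  : ∀ {a a′ b b′} → a ≈ a′ → b ≈ b′ → a ⇒ b ≋ a′ ⇒ b′

≋-refl : ∀ {c} → NonIntersection c → c ≋ c
≋-refl ni-tv = ≋-tv
≋-refl ni-⇒  = ≋-⇒ ≈-refl ≈-refl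

≋-trans : ∀ {c d e} → c ≋ d → d ≋ e → c ≋ e
≋-trans ≋-tv      ≋-tv        = ≋-tv
≋-trans (≋-⇒ a b) (≋-⇒ a′ b′) = ≋-⇒ (≈-trans a a′) (≈-trans b b′)

≋⇒≈ : ∀ {c d} → c ≋ d → c ≈ d
≋⇒≈ ≋-tv      = ≈-refl
≋⇒≈ (≋-⇒ a b) = ⇒-cong a b

_∈≋_ : Ty → Ty → Set
c ∈≋ B = ∃ λ d → d ∈ᶜ B × c ≋ d

_⊆ᶜ_ : Ty → Ty → Set
A ⊆ᶜ B = ∀ {c} → c ∈ᶜ A → c ∈≋ B

⊆⇒⊆ᶜ : ∀ {A B} → (∀ {c} → c ∈ᶜ A → c ∈ᶜ B) → A ⊆ᶜ B
⊆⇒⊆ᶜ A⊆B c∈A = _ , A⊆B c∈A , ≋-refl (∈ᶜ-nonIntersection c∈A)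

⊆ᶜ-refl : ∀ {A} → A ⊆ᶜ A
⊆ᶜ-refl = ⊆⇒⊆ᶜ λ c∈ → c∈

⊆ᶜ-trans : ∀ {A B C} → A ⊆ᶜ B → B ⊆ᶜ C → A ⊆ᶜ C
⊆ᶜ-trans A⊆B B⊆C c∈A with A⊆B c∈A
... | d , d∈B , c≋d with B⊆C d∈B
... | e , e∈C , d≋e = e , e∈C , ≋-trans c≋d d≋e

∩-mono-⊆ᶜ : ∀ {a a′ b b′} → a ⊆ᶜ a′ → b ⊆ᶜ b′ → a ∩ b ⊆ᶜ a′ ∩ b′
∩-mono-⊆ᶜ a⊆a′ b⊆b′ (∩ˡ c∈a) with a⊆a′ c∈a
... | d , d∈ , c≋d = d , ∩ˡ d∈ , c≋d
∩-mono-⊆ᶜ a⊆a′ b⊆b′ (∩ʳ c∈b) with b⊆b′ c∈b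
... | d , d∈ , c≋d = d , ∩ʳ d∈ , c≋d

≈⇒⊆ᶜ : ∀ {A B} → A ≈ B → A ⊆ᶜ B × B ⊆ᶜ A
≈⇒⊆ᶜ ≈-refl              = ⊆ᶜ-refl , ⊆ᶜ-refl
≈⇒⊆ᶜ (≈-sym A≈B)         = swap (≈⇒⊆ᶜ A≈B)
≈⇒⊆ᶜ (≈-trans A≈B B≈C)   with ≈⇒⊆ᶜ A≈B | ≈⇒⊆ᶜ B≈C
... | A⊆B , B⊆A | B⊆C , C⊆B = ⊆ᶜ-trans A⊆B B⊆C , ⊆ᶜ-trans C⊆B B⊆A
≈⇒⊆ᶜ ∩-assoc             = ⊆⇒⊆ᶜ (λ { (∩ˡ (∩ˡ c∈)) → ∩ˡ c∈ ; (∩ˡ (∩ʳ c∈)) → ∩ʳ (∩ˡ c∈) ; (∩ʳ c∈) → ∩ʳ (∩ʳ c∈) })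
                         , ⊆⇒⊆ᶜ (λ { (∩ˡ c∈) → ∩ˡ (∩ˡ c∈) ; (∩ʳ (∩ˡ c∈)) → ∩ˡ (∩ʳ c∈) ; (∩ʳ (∩ʳ c∈)) → ∩ʳ c∈ })
≈⇒⊆ᶜ ∩-comm              = ⊆⇒⊆ᶜ (λ { (∩ˡ c∈) → ∩ʳ c∈ ; (∩ʳ c∈) → ∩ˡ c∈ })
                         , ⊆⇒⊆ᶜ (λ { (∩ˡ c∈) → ∩ʳ c∈ ; (∩ʳ c∈) → ∩ˡ c∈ })
≈⇒⊆ᶜ ∩-idem              = ⊆⇒⊆ᶜ (λ { (∩ˡ c∈) → c∈ ; (∩ʳ c∈) → c∈ }) , ⊆⇒⊆ᶜ ∩ˡ
≈⇒⊆ᶜ (⇒-cong a≈a′ b≈b′)  = (λ { (self _) → _ , self ni-⇒ , ≋-⇒ a≈a′ b≈b′ })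
                         , (λ { (self _) → _ , self ni-⇒ , ≋-⇒ (≈-sym a≈a′) (≈-sym b≈b′) })
≈⇒⊆ᶜ (∩-cong a≈a′ b≈b′)  with ≈⇒⊆ᶜ a≈a′ | ≈⇒⊆ᶜ b≈b′
... | a⊆a′ , a′⊆a | b⊆b′ , b′⊆b = ∩-mono-⊆ᶜ a⊆a′ b⊆b′ , ∩-mono-⊆ᶜ a′⊆a b′⊆b

∈≋-∩⁻ : ∀ {c a b} → c ∈≋ a ∩ b → c ∈≋ a ⊎ c ∈≋ b
∈≋-∩⁻ (d , ∩ˡ d∈ , c≋d) = inj₁ (d , d∈ , c≋d)
∈≋-∩⁻ (d , ∩ʳ d∈ , c≋d) = inj₂ (d , d∈ , c≋d)

⊆ᶜ-∩⁺ : ∀ {a b C} → a ⊆ᶜ C → b ⊆ᶜ C → a ∩ b ⊆ᶜ C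
⊆ᶜ-∩⁺ a⊆C b⊆C (∩ˡ c∈) = a⊆C c∈
⊆ᶜ-∩⁺ a⊆C b⊆C (∩ʳ c∈) = b⊆C c∈

∈≋⇒⊆ᶜ : ∀ {c B} → c ∈≋ B → c ⊆ᶜ B
∈≋⇒⊆ᶜ c∈≋B (self _) = c∈≋B

∩-absorbs-component : ∀ {A c} → c ∈ᶜ A → A ∩ c ≈ A
∩-absorbs-component (self _) = ∩-idem
∩-absorbs-component (∩ˡ c∈a) = ≈-trans ∩-assoc (≈-trans (∩-cong ≈-refl ∩-comm)
                                 (≈-trans (≈-sym ∩-assoc) (∩-cong (∩-absorbs-component c∈a) ≈-refl)))
∩-absorbs-component (∩ʳ c∈b) = ≈-trans ∩-assoc (∩-cong ≈-refl (∩-absorbs-component c∈b))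

∩-absorbs : ∀ A B → B ⊆ᶜ A → A ∩ B ≈ A
∩-absorbs A (a ∩ b) B⊆A = ≈-trans (≈-sym ∩-assoc)
  (≈-trans (∩-cong (∩-absorbs A a (B⊆A ∘ ∩ˡ)) ≈-refl) (∩-absorbs A b (B⊆A ∘ ∩ʳ)))
∩-absorbs A (tv i) B⊆A with B⊆A (self ni-tv)
... | c , c∈A , B≋c = ≈-trans (∩-cong ≈-refl (≋⇒≈ B≋c)) (∩-absorbs-component c∈A)
∩-absorbs A (a ⇒ b) B⊆A with B⊆A (self ni-⇒)
... | c , c∈A , B≋c = ≈-trans (∩-cong ≈-refl (≋⇒≈ B≋c)) (∩-absorbs-component c∈A)

⊆ᶜ-antisym : ∀ {A B} → A ⊆ᶜ B → B ⊆ᶜ A → A ≈ B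
⊆ᶜ-antisym {A} {B} A⊆B B⊆A =
  ≈-trans (≈-sym (∩-absorbs A B B⊆A)) (≈-trans ∩-comm (∩-absorbs B A A⊆B))

≈⇒≋ : ∀ {c d} → NonIntersection c → NonIntersection d → c ≈ d → c ≋ d
≈⇒≋ nc nd c≈d with proj₁ (≈⇒⊆ᶜ c≈d) (self nc) | nd
... | _ , self _ , c≋d | _ = c≋d
... | _ , ∩ˡ _ , _    | ()
... | _ , ∩ʳ _ , _    | ()

infix 4 _≈?_ _≋?_ _∈≋?_ _⊆ᶜ?_

-- A ≈ B iff the components of A and B match up to ≋ (≈⇒⊆ᶜ, ⊆ᶜ-antisym), and ≋ only
-- compares strictly smaller types.
mutual
  _≈?_ : ∀ a b → Dec (a ≈ b)
  a ≈? b = map′ (uncurry ⊆ᶜ-antisym) ≈⇒⊆ᶜ (a ⊆ᶜ? b ×-dec b ⊆ᶜ? a)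

  _≋?_ : ∀ c d → Dec (c ≋ d)
  tv i ≋? tv j with i ℕ.≟ j
  ... | yes refl = yes ≋-tv
  ... | no i≢j   = no λ { ≋-tv → i≢j refl }
  a ⇒ b ≋? a′ ⇒ b′ = map′ (uncurry ≋-⇒) (λ { (≋-⇒ p q) → p , q }) (a ≈? a′ ×-dec b ≈? b′)
  tv _  ≋? _ ⇒ _ = no λ ()
  tv _  ≋? _ ∩ _ = no λ ()
  _ ⇒ _ ≋? tv _  = no λ ()
  _ ⇒ _ ≋? _ ∩ _ = no λ ()
  _ ∩ _ ≋? _     = no λ ()

  _∈≋?_ : ∀ c B → Dec (c ∈≋ B)
  c ∈≋? tv i  = map′ (λ c≋ → _ , self ni-tv , c≋) (λ { (_ , self _ , c≋) → c≋ }) (c ≋? tv i)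
  c ∈≋? a ⇒ b = map′ (λ c≋ → _ , self ni-⇒ , c≋) (λ { (_ , self _ , c≋) → c≋ }) (c ≋? a ⇒ b)
  c ∈≋? a ∩ b = map′ [ (λ { (d , d∈ , c≋d) → d , ∩ˡ d∈ , c≋d }) , (λ { (d , d∈ , c≋d) → d , ∩ʳ d∈ , c≋d }) ]′
                     ∈≋-∩⁻ (c ∈≋? a ⊎-dec c ∈≋? b)

  _⊆ᶜ?_ : ∀ A B → Dec (A ⊆ᶜ B)
  tv i  ⊆ᶜ? B = map′ ∈≋⇒⊆ᶜ (λ A⊆B → A⊆B (self ni-tv)) (tv i ∈≋? B)
  a ⇒ b ⊆ᶜ? B = map′ ∈≋⇒⊆ᶜ (λ A⊆B → A⊆B (self ni-⇒)) (a ⇒ b ∈≋? B)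
  a ∩ b ⊆ᶜ? B = map′ (uncurry ⊆ᶜ-∩⁺) (λ ab⊆B → ab⊆B ∘ ∩ˡ , ab⊆B ∘ ∩ʳ) (a ⊆ᶜ? B ×-dec b ⊆ᶜ? B)

rank-∩ˡ : ∀ a b → rank a ≤ rank (a ∩ b)
rank-∩ˡ a b = ≤-trans (m≤m⊔n (rank a) (rank b)) (m≤n⊔m 1 _)

rank-∩ʳ : ∀ a b → rank b ≤ rank (a ∩ b)
rank-∩ʳ a b = ≤-trans (m≤n⊔m (rank a) (rank b)) (m≤n⊔m 1 _)

rank-dom : ∀ a b {r} → rank (a ⇒ b) ≤ suc r → rank a ≤ r
rank-dom a b le with rank a | rank b
... | zero  | _ = z≤n
... | suc x | y = s≤s⁻¹ (≤-trans (m≤m⊔n (suc (suc x)) y) le)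

rank-cod : ∀ a b → rank b ≤ rank (a ⇒ b)
rank-cod a b with rank a | rank b
... | zero  | zero  = z≤n
... | zero  | suc y = m≤n⊔m 1 (suc y)
... | suc x | y     = m≤n⊔m (suc (suc x)) y

rank-component : ∀ {c A} → c ∈ᶜ A → rank c ≤ rank A
rank-component (self _)            = ≤-refl
rank-component (∩ˡ {a = a} {b} c∈) = ≤-trans (rank-component c∈) (rank-∩ˡ a b)
rank-component (∩ʳ {a = a} {b} c∈) = ≤-trans (rank-component c∈) (rank-∩ʳ a b)

rank≤0⇒nonIntersection : ∀ {t} → rank t ≤ 0 → NonIntersection t
rank≤0⇒nonIntersection {tv i}  _  = ni-tv
rank≤0⇒nonIntersection {a ⇒ b} _  = ni-⇒
rank≤0⇒nonIntersection {a ∩ b} le with ≤-trans (m≤m⊔n 1 (rank a ⊔ rank b)) le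
... | ()

size : Ty → ℕ
size (tv _)  = 1
size (a ⇒ b) = suc (size a + size b)
size (a ∩ b) = suc (size a + size b)

size-component : ∀ {c A} → c ∈ᶜ A → size c ≤ size A
size-component (self _)            = ≤-refl
size-component (∩ˡ {a = a} {b} c∈) = ≤-trans (size-component c∈) (m≤n⇒m≤1+n (m≤m+n (size a) (size b)))
size-component (∩ʳ {a = a} {b} c∈) = ≤-trans (size-component c∈) (m≤n⇒m≤1+n (m≤n+m (size b) (size a)))

size-positive : ∀ A → 1 ≤ size A
size-positive (tv _)  = s≤s z≤n
size-positive (_ ⇒ _) = s≤s z≤n
size-positive (_ ∩ _) = s≤s z≤n

subterms : Ty → List Ty
subterms (tv i)  = tv i ∷ []
subterms (a ⇒ b) = a ⇒ b ∷ subterms a ++ subterms b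
subterms (a ∩ b) = a ∩ b ∷ subterms a ++ subterms b

∈-subterms-refl : ∀ a → a ∈ subterms a
∈-subterms-refl (tv i)  = here refl
∈-subterms-refl (a ⇒ b) = here refl
∈-subterms-refl (a ∩ b) = here refl

∈-subterms-trans : ∀ {a b} c → a ∈ subterms b → b ∈ subterms c → a ∈ subterms c
∈-subterms-trans (tv i)  a∈ (here refl) = a∈
∈-subterms-trans (c ⇒ d) a∈ (here refl) = a∈
∈-subterms-trans (c ∩ d) a∈ (here refl) = a∈
∈-subterms-trans (c ⇒ d) a∈ (there b∈) with ∈-++⁻ (subterms c) b∈
... | inj₁ b∈c = there (∈-++⁺ˡ (∈-subterms-trans c a∈ b∈c))
... | inj₂ b∈d = there (∈-++⁺ʳ (subterms c) (∈-subterms-trans d a∈ b∈d))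
∈-subterms-trans (c ∩ d) a∈ (there b∈) with ∈-++⁻ (subterms c) b∈
... | inj₁ b∈c = there (∈-++⁺ˡ (∈-subterms-trans c a∈ b∈c))
... | inj₂ b∈d = there (∈-++⁺ʳ (subterms c) (∈-subterms-trans d a∈ b∈d))

component∈subterms : ∀ {c A} → c ∈ᶜ A → c ∈ subterms A
component∈subterms (self _)         = ∈-subterms-refl _
component∈subterms (∩ˡ c∈)          = there (∈-++⁺ˡ (component∈subterms c∈))
component∈subterms (∩ʳ {a = a} c∈) = there (∈-++⁺ʳ (subterms a) (component∈subterms c∈))

subterms-⇒-closed : ∀ τ {a b} → a ⇒ b ∈ subterms τ → a ∈ subterms τ × b ∈ subterms τ
subterms-⇒-closed τ {a} {b} ⇒∈ =
  ∈-subterms-trans τ (there (∈-++⁺ˡ (∈-subterms-refl a))) ⇒∈ ,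
  ∈-subterms-trans τ (there (∈-++⁺ʳ (subterms a) (∈-subterms-refl b))) ⇒∈

subterms-component-closed : ∀ τ {C c} → C ∈ subterms τ → c ∈ᶜ C → c ∈ subterms τ
subterms-component-closed τ C∈ c∈ = ∈-subterms-trans τ (component∈subterms c∈) C∈

-- Substitution and typing

Ren : ℕ → ℕ → Set
Ren n m = Fin n → Fin m

liftʳ : ∀ {n m} → Ren n m → Ren (suc n) (suc m)
liftʳ ρ zero    = zero
liftʳ ρ (suc x) = suc (ρ x)

ren : ∀ {n m} → Ren n m → Tm n → Tm m
ren ρ (var x)   = var (ρ x)
ren ρ (app M N) = app (ren ρ M) (ren ρ N)
ren ρ (lam M)   = lam (ren (liftʳ ρ) M)

Sub : ℕ → ℕ → Set
Sub n m = Fin n → Tm m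

liftˢ : ∀ {n m} → Sub n m → Sub (suc n) (suc m)
liftˢ σ zero    = var zero
liftˢ σ (suc x) = ren suc (σ x)

sub : ∀ {n m} → Sub n m → Tm n → Tm m
sub σ (var x)   = σ x
sub σ (app M N) = app (sub σ M) (sub σ N)
sub σ (lam M)   = lam (sub (liftˢ σ) M)

infixr 5 _∷ˢ_
_∷ˢ_ : ∀ {n m} → Tm m → Sub n m → Sub (suc n) m
(N ∷ˢ σ) zero    = N
(N ∷ˢ σ) (suc x) = σ x

infix 8 _[_]
_[_] : ∀ {n} → Tm (suc n) → Tm n → Tm n
M [ N ] = sub (N ∷ˢ var) M

ren-cong : ∀ {n m} {ρ ρ′ : Ren n m} → (∀ x → ρ x ≡ ρ′ x) → ∀ M → ren ρ M ≡ ren ρ′ M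
ren-cong ρ≗ρ′ (var x)   = cong var (ρ≗ρ′ x)
ren-cong ρ≗ρ′ (app M N) = cong₂ app (ren-cong ρ≗ρ′ M) (ren-cong ρ≗ρ′ N)
ren-cong ρ≗ρ′ (lam M)   = cong lam (ren-cong (λ { zero → refl ; (suc x) → cong suc (ρ≗ρ′ x) }) M)

sub-cong : ∀ {n m} {σ σ′ : Sub n m} → (∀ x → σ x ≡ σ′ x) → ∀ M → sub σ M ≡ sub σ′ M
sub-cong σ≗σ′ (var x)   = σ≗σ′ x
sub-cong σ≗σ′ (app M N) = cong₂ app (sub-cong σ≗σ′ M) (sub-cong σ≗σ′ N)
sub-cong σ≗σ′ (lam M)   = cong lam (sub-cong (λ { zero → refl ; (suc x) → cong (ren suc) (σ≗σ′ x) }) M)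

ren-ren : ∀ {n m k} (ρ : Ren m k) (ρ′ : Ren n m) M → ren ρ (ren ρ′ M) ≡ ren (ρ ∘ ρ′) M
ren-ren ρ ρ′ (var x)   = refl
ren-ren ρ ρ′ (app M N) = cong₂ app (ren-ren ρ ρ′ M) (ren-ren ρ ρ′ N)
ren-ren ρ ρ′ (lam M)   =
  cong lam (trans (ren-ren (liftʳ ρ) (liftʳ ρ′) M) (ren-cong (λ { zero → refl ; (suc x) → refl }) M))

ren≡sub : ∀ {n m} (ρ : Ren n m) M → ren ρ M ≡ sub (var ∘ ρ) M
ren≡sub ρ (var x)   = refl
ren≡sub ρ (app M N) = cong₂ app (ren≡sub ρ M) (ren≡sub ρ N)
ren≡sub ρ (lam M)   =
  cong lam (trans (ren≡sub (liftʳ ρ) M) (sub-cong (λ { zero → refl ; (suc x) → refl }) M))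

ren-sub : ∀ {n m k} (ρ : Ren m k) (σ : Sub n m) M → ren ρ (sub σ M) ≡ sub (ren ρ ∘ σ) M
ren-sub ρ σ (var x)   = refl
ren-sub ρ σ (app M N) = cong₂ app (ren-sub ρ σ M) (ren-sub ρ σ N)
ren-sub ρ σ (lam M)   = cong lam (trans (ren-sub (liftʳ ρ) (liftˢ σ) M) (sub-cong lift-comm M))
  where
  lift-comm : ∀ x → ren (liftʳ ρ) (liftˢ σ x) ≡ liftˢ (ren ρ ∘ σ) x
  lift-comm zero    = refl
  lift-comm (suc x) = trans (ren-ren (liftʳ ρ) suc (σ x)) (sym (ren-ren suc ρ (σ x)))

sub-ren : ∀ {n m k} (σ : Sub m k) (ρ : Ren n m) M → sub σ (ren ρ M) ≡ sub (σ ∘ ρ) M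
sub-ren σ ρ (var x)   = refl
sub-ren σ ρ (app M N) = cong₂ app (sub-ren σ ρ M) (sub-ren σ ρ N)
sub-ren σ ρ (lam M)   =
  cong lam (trans (sub-ren (liftˢ σ) (liftʳ ρ) M) (sub-cong (λ { zero → refl ; (suc x) → refl }) M))

sub-sub : ∀ {n m k} (σ : Sub m k) (σ′ : Sub n m) M → sub σ (sub σ′ M) ≡ sub (sub σ ∘ σ′) M
sub-sub σ σ′ (var x)   = refl
sub-sub σ σ′ (app M N) = cong₂ app (sub-sub σ σ′ M) (sub-sub σ σ′ N)
sub-sub σ σ′ (lam M)   = cong lam (trans (sub-sub (liftˢ σ) (liftˢ σ′) M) (sub-cong lift-comm M))
  where
  lift-comm : ∀ x → sub (liftˢ σ) (liftˢ σ′ x) ≡ liftˢ (sub σ ∘ σ′) x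
  lift-comm zero    = refl
  lift-comm (suc x) = trans (sub-ren (liftˢ σ) suc (σ′ x)) (sym (ren-sub suc σ (σ′ x)))

sub-id : ∀ {n} (M : Tm n) → sub var M ≡ M
sub-id (var x)   = refl
sub-id (app M N) = cong₂ app (sub-id M) (sub-id N)
sub-id (lam M)   = cong lam (trans (sub-cong (λ { zero → refl ; (suc x) → refl }) M) (sub-id M))

sub-liftˢ-[] : ∀ {n m} (σ : Sub n m) M N → sub (liftˢ σ) M [ N ] ≡ sub (N ∷ˢ σ) M
sub-liftˢ-[] σ M N = trans (sub-sub (N ∷ˢ var) (liftˢ σ) M) (sub-cong cancel M)
  where
  cancel : ∀ x → sub (N ∷ˢ var) (liftˢ σ x) ≡ (N ∷ˢ σ) x
  cancel zero    = refl
  cancel (suc x) = trans (sub-ren (N ∷ˢ var) suc (σ x)) (sub-id (σ x))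

ren-[] : ∀ {n m} (ρ : Ren n m) M N → ren ρ (M [ N ]) ≡ ren (liftʳ ρ) M [ ren ρ N ]
ren-[] ρ M N = trans (ren-sub ρ (N ∷ˢ var) M)
  (trans (sub-cong (λ { zero → refl ; (suc x) → refl }) M) (sym (sub-ren (ren ρ N ∷ˢ var) (liftʳ ρ) M)))

module _ {n} {Γ : Env n} {M : Tm n} where

  ⊢-component : ∀ {A c} → c ∈ᶜ A → Γ ⊢ M ∶ A → Γ ⊢ M ∶ c
  ⊢-component (self _) ⊢M = ⊢M
  ⊢-component (∩ˡ c∈)  ⊢M = ⊢-component c∈ (E∩₁ ⊢M)
  ⊢-component (∩ʳ c∈)  ⊢M = ⊢-component c∈ (E∩₂ ⊢M)

  ⊢-components : ∀ A → (∀ {c} → c ∈ᶜ A → Γ ⊢ M ∶ c) → Γ ⊢ M ∶ A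
  ⊢-components (tv i)  ⊢c = ⊢c (self ni-tv)
  ⊢-components (a ⇒ b) ⊢c = ⊢c (self ni-⇒)
  ⊢-components (a ∩ b) ⊢c = I∩ (⊢-components a (⊢c ∘ ∩ˡ)) (⊢-components b (⊢c ∘ ∩ʳ))

⊢-ren : ∀ {n m} {Γ : Env n} {Δ : Env m} (ρ : Ren n m) → (∀ x → lookup Δ (ρ x) ≡ lookup Γ x) →
        ∀ {M A} → Γ ⊢ M ∶ A → Δ ⊢ ren ρ M ∶ A
⊢-ren ρ Δρ≡Γ (VAR x)        = subst (_ ⊢ var (ρ x) ∶_) (Δρ≡Γ x) (VAR (ρ x))
⊢-ren ρ Δρ≡Γ (E⇒ ⊢M ⊢N)     = E⇒ (⊢-ren ρ Δρ≡Γ ⊢M) (⊢-ren ρ Δρ≡Γ ⊢N)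
⊢-ren ρ Δρ≡Γ (I⇒ ⊢M)        = I⇒ (⊢-ren (liftʳ ρ) (λ { zero → refl ; (suc x) → Δρ≡Γ x }) ⊢M)
⊢-ren ρ Δρ≡Γ (E∩₁ ⊢M)       = E∩₁ (⊢-ren ρ Δρ≡Γ ⊢M)
⊢-ren ρ Δρ≡Γ (E∩₂ ⊢M)       = E∩₂ (⊢-ren ρ Δρ≡Γ ⊢M)
⊢-ren ρ Δρ≡Γ (I∩ ⊢M ⊢M′)    = I∩ (⊢-ren ρ Δρ≡Γ ⊢M) (⊢-ren ρ Δρ≡Γ ⊢M′)
⊢-ren ρ Δρ≡Γ (≈-ty ⊢M A≈B)  = ≈-ty (⊢-ren ρ Δρ≡Γ ⊢M) A≈B

⊢-sub : ∀ {n m} {Γ : Env n} {Δ : Env m} (σ : Sub n m) → (∀ x → Δ ⊢ σ x ∶ lookup Γ x) →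
        ∀ {M A} → Γ ⊢ M ∶ A → Δ ⊢ sub σ M ∶ A
⊢-sub σ ⊢σ (VAR x)        = ⊢σ x
⊢-sub σ ⊢σ (E⇒ ⊢M ⊢N)     = E⇒ (⊢-sub σ ⊢σ ⊢M) (⊢-sub σ ⊢σ ⊢N)
⊢-sub σ ⊢σ (I⇒ ⊢M)        = I⇒ (⊢-sub (liftˢ σ) (λ { zero → VAR zero ; (suc x) → ⊢-ren suc (λ _ → refl) (⊢σ x) }) ⊢M)
⊢-sub σ ⊢σ (E∩₁ ⊢M)       = E∩₁ (⊢-sub σ ⊢σ ⊢M)
⊢-sub σ ⊢σ (E∩₂ ⊢M)       = E∩₂ (⊢-sub σ ⊢σ ⊢M)
⊢-sub σ ⊢σ (I∩ ⊢M ⊢M′)    = I∩ (⊢-sub σ ⊢σ ⊢M) (⊢-sub σ ⊢σ ⊢M′)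
⊢-sub σ ⊢σ (≈-ty ⊢M A≈B)  = ≈-ty (⊢-sub σ ⊢σ ⊢M) A≈B

⊢-[] : ∀ {n} {Γ : Env n} {M N a A} → (a ∷ Γ) ⊢ M ∶ A → Γ ⊢ N ∶ a → Γ ⊢ M [ N ] ∶ A
⊢-[] ⊢M ⊢N = ⊢-sub (_ ∷ˢ var) (λ { zero → ⊢N ; (suc x) → VAR x }) ⊢M

⊢-resp-≈ᴱ : ∀ {n} {Γ Δ : Env n} → (∀ x → lookup Γ x ≈ lookup Δ x) → ∀ {M A} → Γ ⊢ M ∶ A → Δ ⊢ M ∶ A
⊢-resp-≈ᴱ Γ≈Δ ⊢M = subst (_ ⊢_∶ _) (sub-id _) (⊢-sub var (λ x → ≈-ty (VAR x) (≈-sym (Γ≈Δ x))) ⊢M)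

⊢-lam⁻ : ∀ {n} {Γ : Env n} {M A c} → Γ ⊢ lam M ∶ A → c ∈ᶜ A →
         ∃₂ λ a b → c ≡ a ⇒ b × (a ∷ Γ) ⊢ M ∶ b
⊢-lam⁻ (I⇒ ⊢M)      (self _) = _ , _ , refl , ⊢M
⊢-lam⁻ (E∩₁ ⊢M)     c∈       = ⊢-lam⁻ ⊢M (∩ˡ c∈)
⊢-lam⁻ (E∩₂ ⊢M)     c∈       = ⊢-lam⁻ ⊢M (∩ʳ c∈)
⊢-lam⁻ (I∩ ⊢M _)    (∩ˡ c∈)  = ⊢-lam⁻ ⊢M c∈
⊢-lam⁻ (I∩ _ ⊢M)    (∩ʳ c∈)  = ⊢-lam⁻ ⊢M c∈
⊢-lam⁻ (≈-ty ⊢M A′≈A) c∈ with proj₂ (≈⇒⊆ᶜ A′≈A) c∈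
... | c′ , c′∈ , c≋c′ with ⊢-lam⁻ ⊢M c′∈
... | a′ , b′ , refl , ⊢M′ with c≋c′
... | ≋-⇒ a≈a′ b≈b′ = _ , _ , refl , ≈-ty (⊢-resp-≈ᴱ (λ { zero → ≈-sym a≈a′ ; (suc x) → ≈-refl }) ⊢M′) (≈-sym b≈b′)

⊢-lam-⇒⁻ : ∀ {n} {Γ : Env n} {M a b} → Γ ⊢ lam M ∶ a ⇒ b → (a ∷ Γ) ⊢ M ∶ b
⊢-lam-⇒⁻ ⊢M with ⊢-lam⁻ ⊢M (self ni-⇒)
... | _ , _ , refl , ⊢M′ = ⊢M′

-- Typable terms have normal forms

infix 4 _⟶ʰ_

data _⟶ʰ_ {n} : Tm n → Tm n → Set where
  β : ∀ {M N} → app (lam M) N ⟶ʰ M [ N ]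
  ξ : ∀ {M M′ N} → M ⟶ʰ M′ → app M N ⟶ʰ app M′ N

mutual
  data WN {n} : Tm n → Set where
    wn-ne  : ∀ {M} → WNe M → WN M
    wn-lam : ∀ {M} → WN M → WN (lam M)
    wn-exp : ∀ {M M′} → M ⟶ʰ M′ → WN M′ → WN M

  data WNe {n} : Tm n → Set where
    wne-var : ∀ x → WNe (var x)
    wne-app : ∀ {M N} → WNe M → WN N → WNe (app M N)

ren-reflects-⟶ʰ : ∀ {n m} {ρ : Ren n m} {T T′} → T ⟶ʰ T′ → ∀ P → T ≡ ren ρ P →
                  ∃ λ P′ → P ⟶ʰ P′ × T′ ≡ ren ρ P′
ren-reflects-⟶ʰ {ρ = ρ} β (app (lam M) N) refl = M [ N ] , β , sym (ren-[] ρ M N)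
ren-reflects-⟶ʰ (ξ s) (app M N) refl with ren-reflects-⟶ʰ s M refl
... | M′ , s′ , refl = app M′ N , ξ s′ , refl

mutual
  ren-reflects-WN : ∀ {n m} {ρ : Ren n m} {T} → WN T → ∀ P → T ≡ ren ρ P → WN P
  ren-reflects-WN (wn-ne e)    P       eq   = wn-ne (ren-reflects-WNe e P eq)
  ren-reflects-WN (wn-lam w)   (lam P) refl = wn-lam (ren-reflects-WN w P refl)
  ren-reflects-WN (wn-exp s w) P       eq   with ren-reflects-⟶ʰ s P eq
  ... | P′ , s′ , eq′ = wn-exp s′ (ren-reflects-WN w P′ eq′)

  ren-reflects-WNe : ∀ {n m} {ρ : Ren n m} {T} → WNe T → ∀ P → T ≡ ren ρ P → WNe P
  ren-reflects-WNe (wne-var _)   (var y)   refl = wne-var y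
  ren-reflects-WNe (wne-app e w) (app M N) refl = wne-app (ren-reflects-WNe e M refl) (ren-reflects-WN w N refl)

WN-app-var⁻ : ∀ {n} {M : Tm n} {x} → WN (app M (var x)) → WN M
WN-app-var⁻ (wn-ne (wne-app e _))    = wn-ne e
WN-app-var⁻ (wn-exp (ξ s) w)         = wn-exp s (WN-app-var⁻ w)
WN-app-var⁻ {x = x} (wn-exp (β {M = M}) w) =
  wn-lam (ren-reflects-WN w M (trans (sub-cong (λ { zero → refl ; (suc y) → refl }) M) (sym (ren≡sub ρ M))))
  where
  ρ : Ren (suc _) _
  ρ zero    = x
  ρ (suc y) = y

⟦_⟧ : ∀ {m} → Ty → Tm m → Set
⟦ tv i ⟧  M = WN M
⟦ a ⇒ b ⟧ M = ∀ N → ⟦ a ⟧ N → ⟦ b ⟧ (app M N)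
⟦ a ∩ b ⟧ M = ⟦ a ⟧ M × ⟦ b ⟧ M

-- A variable in scope is needed to probe the arrow case.
mutual
  ⟦⟧⇒WN : ∀ {k} A {M : Tm (suc k)} → ⟦ A ⟧ M → WN M
  ⟦⟧⇒WN (tv i)  r = r
  ⟦⟧⇒WN (a ⇒ b) r = WN-app-var⁻ (⟦⟧⇒WN b (r (var zero) (WNe⇒⟦⟧ a (wne-var zero))))
  ⟦⟧⇒WN (a ∩ b) r = ⟦⟧⇒WN a (proj₁ r)

  WNe⇒⟦⟧ : ∀ {k} A {M : Tm (suc k)} → WNe M → ⟦ A ⟧ M
  WNe⇒⟦⟧ (tv i)  e = wn-ne e
  WNe⇒⟦⟧ (a ⇒ b) e = λ N r → WNe⇒⟦⟧ b (wne-app e (⟦⟧⇒WN a r))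
  WNe⇒⟦⟧ (a ∩ b) e = WNe⇒⟦⟧ a e , WNe⇒⟦⟧ b e

⟦⟧-expand : ∀ {m} A {M M′ : Tm m} → M ⟶ʰ M′ → ⟦ A ⟧ M′ → ⟦ A ⟧ M
⟦⟧-expand (tv i)  s r = wn-exp s r
⟦⟧-expand (a ⇒ b) s r = λ N rN → ⟦⟧-expand b (ξ s) (r N rN)
⟦⟧-expand (a ∩ b) s r = ⟦⟧-expand a s (proj₁ r) , ⟦⟧-expand b s (proj₂ r)

⟦⟧-resp-≈ : ∀ {m A B} → A ≈ B → (∀ {M : Tm m} → ⟦ A ⟧ M → ⟦ B ⟧ M) × (∀ {M : Tm m} → ⟦ B ⟧ M → ⟦ A ⟧ M)
⟦⟧-resp-≈ ≈-refl           = (λ r → r) , (λ r → r)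
⟦⟧-resp-≈ (≈-sym A≈B)      with ⟦⟧-resp-≈ A≈B
... | to , from = from , to
⟦⟧-resp-≈ (≈-trans A≈B B≈C) with ⟦⟧-resp-≈ A≈B | ⟦⟧-resp-≈ B≈C
... | to , from | to′ , from′ = to′ ∘ to , from ∘ from′
⟦⟧-resp-≈ ∩-assoc          = (λ { ((x , y) , z) → x , (y , z) }) , (λ { (x , (y , z)) → (x , y) , z })
⟦⟧-resp-≈ ∩-comm           = (λ { (x , y) → y , x }) , (λ { (x , y) → y , x })
⟦⟧-resp-≈ ∩-idem           = proj₁ , (λ r → r , r)
⟦⟧-resp-≈ (⇒-cong a≈ b≈)   with ⟦⟧-resp-≈ a≈ | ⟦⟧-resp-≈ b≈
... | to , from | to′ , from′ = (λ r N rN → to′ (r N (from rN))) , (λ r N rN → from′ (r N (to rN)))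
⟦⟧-resp-≈ (∩-cong a≈ b≈)   with ⟦⟧-resp-≈ a≈ | ⟦⟧-resp-≈ b≈
... | to , from | to′ , from′ = (λ { (x , y) → to x , to′ y }) , (λ { (x , y) → from x , from′ y })

fundamental : ∀ {n m} {Γ : Env n} {M A} → Γ ⊢ M ∶ A →
              (σ : Sub n m) → (∀ x → ⟦ lookup Γ x ⟧ (σ x)) → ⟦ A ⟧ (sub σ M)
fundamental (VAR x)      σ ⟦σ⟧ = ⟦σ⟧ x
fundamental (E⇒ ⊢M ⊢N)   σ ⟦σ⟧ = fundamental ⊢M σ ⟦σ⟧ _ (fundamental ⊢N σ ⟦σ⟧)
fundamental (I⇒ {M = M} {b = b} ⊢M) σ ⟦σ⟧ = λ N ⟦N⟧ →
  ⟦⟧-expand b β (subst ⟦ b ⟧ (sym (sub-liftˢ-[] σ M N))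
    (fundamental ⊢M (N ∷ˢ σ) λ { zero → ⟦N⟧ ; (suc x) → ⟦σ⟧ x }))
fundamental (E∩₁ ⊢M)     σ ⟦σ⟧ = proj₁ (fundamental ⊢M σ ⟦σ⟧)
fundamental (E∩₂ ⊢M)     σ ⟦σ⟧ = proj₂ (fundamental ⊢M σ ⟦σ⟧)
fundamental (I∩ ⊢M ⊢M′)  σ ⟦σ⟧ = fundamental ⊢M σ ⟦σ⟧ , fundamental ⊢M′ σ ⟦σ⟧
fundamental (≈-ty ⊢M A≈B) σ ⟦σ⟧ = proj₁ (⟦⟧-resp-≈ A≈B) (fundamental ⊢M σ ⟦σ⟧)

⊢⇒WN : ∀ {n} {Γ : Env n} {M A} → Γ ⊢ M ∶ A → WN M
⊢⇒WN {Γ = Γ} {M} {A} ⊢M =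
  ren-reflects-WN (⟦⟧⇒WN A (fundamental ⊢M (var ∘ suc) (λ x → WNe⇒⟦⟧ (lookup Γ x) (wne-var (suc x)))))
                  M (sym (ren≡sub suc M))

subject-reduction : ∀ {n} {Γ : Env n} {M M′ A} → M ⟶ʰ M′ → Γ ⊢ M ∶ A → Γ ⊢ M′ ∶ A
subject-reduction β     (E⇒ ⊢λM ⊢N)  = ⊢-[] (⊢-lam-⇒⁻ ⊢λM) ⊢N
subject-reduction (ξ s) (E⇒ ⊢M ⊢N)   = E⇒ (subject-reduction s ⊢M) ⊢N
subject-reduction s     (E∩₁ ⊢M)     = E∩₁ (subject-reduction s ⊢M)
subject-reduction s     (E∩₂ ⊢M)     = E∩₂ (subject-reduction s ⊢M)
subject-reduction s     (I∩ ⊢M ⊢M′)  = I∩ (subject-reduction s ⊢M) (subject-reduction s ⊢M′)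
subject-reduction s     (≈-ty ⊢M A≈B) = ≈-ty (subject-reduction s ⊢M) A≈B

infixl 5 _·*_
_·*_ : ∀ {n} → Tm n → List (Tm n) → Tm n
_·*_ = foldl app

data Nf {n} : Tm n → Set where
  nf-lam : ∀ {M} → Nf M → Nf (lam M)
  nf-ne  : ∀ x {Ns} → Allᴸ Nf Ns → Nf (var x ·* Ns)

infix 4 _⊢⊆_
_⊢⊆_ : ∀ {n} → Tm n → Tm n → Set
M ⊢⊆ N = ∀ {Γ A} → Γ ⊢ M ∶ A → Γ ⊢ N ∶ A

lam-⊢⊆ : ∀ {n} {M M′ : Tm (suc n)} → M ⊢⊆ M′ → lam M ⊢⊆ lam M′
lam-⊢⊆ M⊆ (I⇒ ⊢M)       = I⇒ (M⊆ ⊢M)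
lam-⊢⊆ M⊆ (E∩₁ ⊢M)      = E∩₁ (lam-⊢⊆ M⊆ ⊢M)
lam-⊢⊆ M⊆ (E∩₂ ⊢M)      = E∩₂ (lam-⊢⊆ M⊆ ⊢M)
lam-⊢⊆ M⊆ (I∩ ⊢M ⊢M′)   = I∩ (lam-⊢⊆ M⊆ ⊢M) (lam-⊢⊆ M⊆ ⊢M′)
lam-⊢⊆ M⊆ (≈-ty ⊢M A≈B) = ≈-ty (lam-⊢⊆ M⊆ ⊢M) A≈B

app-⊢⊆ : ∀ {n} {M M′ N N′ : Tm n} → M ⊢⊆ M′ → N ⊢⊆ N′ → app M N ⊢⊆ app M′ N′
app-⊢⊆ M⊆ N⊆ (E⇒ ⊢M ⊢N)    = E⇒ (M⊆ ⊢M) (N⊆ ⊢N)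
app-⊢⊆ M⊆ N⊆ (E∩₁ ⊢M)      = E∩₁ (app-⊢⊆ M⊆ N⊆ ⊢M)
app-⊢⊆ M⊆ N⊆ (E∩₂ ⊢M)      = E∩₂ (app-⊢⊆ M⊆ N⊆ ⊢M)
app-⊢⊆ M⊆ N⊆ (I∩ ⊢M ⊢M′)   = I∩ (app-⊢⊆ M⊆ N⊆ ⊢M) (app-⊢⊆ M⊆ N⊆ ⊢M′)
app-⊢⊆ M⊆ N⊆ (≈-ty ⊢M A≈B) = ≈-ty (app-⊢⊆ M⊆ N⊆ ⊢M) A≈B

mutual
  WN⇒Nf : ∀ {n} {M : Tm n} → WN M → ∃ λ N → Nf N × M ⊢⊆ N
  WN⇒Nf (wn-ne e) with WNe⇒Nf e
  ... | x , Ns , nfs , M⊆ = var x ·* Ns , nf-ne x nfs , M⊆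
  WN⇒Nf (wn-lam w) with WN⇒Nf w
  ... | N , nf , M⊆ = lam N , nf-lam nf , lam-⊢⊆ M⊆
  WN⇒Nf (wn-exp s w) with WN⇒Nf w
  ... | N , nf , M′⊆ = N , nf , M′⊆ ∘ subject-reduction s

  WNe⇒Nf : ∀ {n} {M : Tm n} → WNe M → ∃₂ λ x Ns → Allᴸ Nf Ns × M ⊢⊆ var x ·* Ns
  WNe⇒Nf (wne-var x) = x , [] , [] , λ ⊢M → ⊢M
  WNe⇒Nf (wne-app e w) with WNe⇒Nf e | WN⇒Nf w
  ... | x , Ns , nfs , M⊆ | N , nf , N⊆ =
    x , Ns ∷ʳ N , ∷ʳ⁺ nfs nf , subst (_ ⊢_∶ _) (sym (foldl-∷ʳ app (var x) N Ns)) ∘ app-⊢⊆ M⊆ N⊆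

normal-inhabitant : ∀ {τ} → Inhabited τ → ∃ λ N → Nf N × [] ⊢ N ∶ τ
normal-inhabitant (M , ⊢M) with WN⇒Nf (⊢⇒WN ⊢M)
... | N , nf , M⊆ = N , nf , M⊆ ⊢M

-- Inversion for applications of a head variable

infix 4 _⟨_⟩↝_

data _⟨_⟩↝_ : Ty → List Ty → Ty → Set where
  done : ∀ {C c} → c ∈ᶜ C → C ⟨ [] ⟩↝ c
  apply : ∀ {C a B as c} → a ⇒ B ∈ᶜ C → B ⟨ as ⟩↝ c → C ⟨ a ∷ as ⟩↝ c

↝-∷ʳ : ∀ {C as a B c} → C ⟨ as ⟩↝ a ⇒ B → c ∈ᶜ B → C ⟨ as ∷ʳ a ⟩↝ c
↝-∷ʳ (done ⇒∈)     c∈ = apply ⇒∈ (done c∈)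
↝-∷ʳ (apply ⇒∈ ↝c) c∈ = apply ⇒∈ (↝-∷ʳ ↝c c∈)

↝-nonIntersection : ∀ {C as c} → C ⟨ as ⟩↝ c → NonIntersection c
↝-nonIntersection (done c∈)   = ∈ᶜ-nonIntersection c∈
↝-nonIntersection (apply _ ↝c) = ↝-nonIntersection ↝c

app-·* : ∀ {n} (M N : Tm n) Ns → ∃₂ λ M′ N′ → app M N ·* Ns ≡ app M′ N′
app-·* M N []        = M , N , refl
app-·* M N (N′ ∷ Ns) = app-·* (app M N) N′ Ns

var·*≡var⁻ : ∀ {n} {x y : Fin n} Ns → var x ·* Ns ≡ var y → Ns ≡ [] × x ≡ y
var·*≡var⁻ []       refl = refl , refl
var·*≡var⁻ (N ∷ Ns) eq   with app-·* (var _) N Ns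
... | _ , _ , eq′ with trans (sym eq′) eq
... | ()

var·*≢lam : ∀ {n} {x : Fin n} {M} Ns → var x ·* Ns ≢ lam M
var·*≢lam []       ()
var·*≢lam (N ∷ Ns) eq with app-·* (var _) N Ns
... | _ , _ , eq′ with trans (sym eq′) eq
... | ()

·*≡app⁻ : ∀ {n} (h : Tm n) Ns {M N} → h ·* Ns ≡ app M N →
          (Ns ≡ [] × h ≡ app M N) ⊎ ∃ λ Ns′ → Ns ≡ Ns′ ∷ʳ N × M ≡ h ·* Ns′
·*≡app⁻ h []        eq = inj₁ (refl , eq)
·*≡app⁻ h (N′ ∷ Ns) eq with ·*≡app⁻ (app h N′) Ns eq
... | inj₁ (refl , refl)       = inj₂ ([] , refl , refl)
... | inj₂ (Ns′ , refl , refl) = inj₂ (N′ ∷ Ns′ , refl , refl)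

⊢-var·*⁻ : ∀ {n} {Γ : Env n} {T A t} → Γ ⊢ T ∶ A → ∀ x Ns → T ≡ var x ·* Ns → t ∈ᶜ A →
           ∃₂ λ as c → lookup Γ x ⟨ as ⟩↝ c × c ≈ t × Pointwiseᴸ (Γ ⊢_∶_) Ns as
⊢-var·*⁻ (VAR y) x Ns eq t∈ with var·*≡var⁻ Ns (sym eq)
... | refl , refl = [] , _ , done t∈ , ≈-refl , []
⊢-var·*⁻ (E⇒ ⊢M ⊢N) x Ns eq t∈ with ·*≡app⁻ (var x) Ns (sym eq)
... | inj₁ (_ , ())
... | inj₂ (Ns′ , refl , M≡) with ⊢-var·*⁻ ⊢M x Ns′ M≡ (self ni-⇒)
... | as , c , ↝c , c≈a⇒b , ⊢Ns′ with ≈⇒≋ (↝-nonIntersection ↝c) ni-⇒ c≈a⇒b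
... | ≋-⇒ a′≈a b′≈b with proj₂ (≈⇒⊆ᶜ b′≈b) t∈
... | t′ , t′∈ , t≋t′ =
  as ∷ʳ _ , t′ , ↝-∷ʳ ↝c t′∈ , ≈-sym (≋⇒≈ t≋t′) , ++⁺ ⊢Ns′ (≈-ty ⊢N (≈-sym a′≈a) ∷ [])
⊢-var·*⁻ (I⇒ _)       x Ns eq t∈      with var·*≢lam Ns (sym eq)
... | ()
⊢-var·*⁻ (E∩₁ ⊢M)     x Ns eq t∈      = ⊢-var·*⁻ ⊢M x Ns eq (∩ˡ t∈)
⊢-var·*⁻ (E∩₂ ⊢M)     x Ns eq t∈      = ⊢-var·*⁻ ⊢M x Ns eq (∩ʳ t∈)
⊢-var·*⁻ (I∩ ⊢M _)    x Ns eq (∩ˡ t∈) = ⊢-var·*⁻ ⊢M x Ns eq t∈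
⊢-var·*⁻ (I∩ _ ⊢M)    x Ns eq (∩ʳ t∈) = ⊢-var·*⁻ ⊢M x Ns eq t∈
⊢-var·*⁻ (≈-ty ⊢M A′≈A) x Ns eq t∈ with proj₂ (≈⇒⊆ᶜ A′≈A) t∈
... | t′ , t′∈ , t≋t′ with ⊢-var·*⁻ ⊢M x Ns eq t′∈
... | as , c , ↝c , c≈t′ , ⊢Ns = as , c , ↝c , ≈-trans c≈t′ (≈-sym (≋⇒≈ t≋t′)) , ⊢Ns

-- Inhabiting several rank-1 environments by one term

Profile : ℕ → Set
Profile = Vec Ty

data Mode (k : ℕ) : Set where
  intro : Mode k
  elim  : Profile k → Mode k

-- A profile has one type for each of the k problems solved simultaneously.
-- (V , t , intro): find a term of profile t whose free variables have profiles in V;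
-- (V , t , elim C): apply a head of profile C to such terms until profile t is reached.
State : ℕ → Set
State k = List (Profile k) × Profile k × Mode k

splitArrows : ∀ {k} → Profile k → Maybe (Profile k × Profile k)
splitArrows []          = just ([] , [])
splitArrows (a ⇒ b ∷ t) = Maybe.map (λ (as , bs) → a ∷ as , b ∷ bs) (splitArrows t)
splitArrows (tv _ ∷ _)  = nothing
splitArrows (_ ∩ _ ∷ _) = nothing

splitArrows-sound : ∀ {k} (t : Profile k) {a b} → splitArrows t ≡ just (a , b) → t ≡ zipWith _⇒_ a b
splitArrows-sound []          refl = refl
splitArrows-sound (c ⇒ d ∷ t) eq   with splitArrows t in split≡ | eq
... | just _ | refl = cong (c ⇒ d ∷_) (splitArrows-sound t split≡)

splitArrows-zipWith : ∀ {k} (a b : Profile k) → splitArrows (zipWith _⇒_ a b) ≡ just (a , b)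
splitArrows-zipWith []      []      = refl
splitArrows-zipWith (x ∷ a) (y ∷ b) rewrite splitArrows-zipWith a b = refl

arrowComponents : Ty → List (Ty × Ty)
arrowComponents (tv _)  = []
arrowComponents (a ⇒ b) = (a , b) ∷ []
arrowComponents (a ∩ b) = arrowComponents a ++ arrowComponents b

∈-arrowComponents⁺ : ∀ {a b C} → a ⇒ b ∈ᶜ C → (a , b) ∈ arrowComponents C
∈-arrowComponents⁺ (self _)         = here refl
∈-arrowComponents⁺ (∩ˡ ⇒∈)          = ∈-++⁺ˡ (∈-arrowComponents⁺ ⇒∈)
∈-arrowComponents⁺ (∩ʳ {a = c} ⇒∈) = ∈-++⁺ʳ (arrowComponents c) (∈-arrowComponents⁺ ⇒∈)

∈-arrowComponents⁻ : ∀ C {a b} → (a , b) ∈ arrowComponents C → a ⇒ b ∈ᶜ C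
∈-arrowComponents⁻ (c ⇒ d) (here refl) = self ni-⇒
∈-arrowComponents⁻ (c ∩ d) ab∈ with ∈-++⁻ (arrowComponents c) ab∈
... | inj₁ ab∈c = ∩ˡ (∈-arrowComponents⁻ c ab∈c)
... | inj₂ ab∈d = ∩ʳ (∈-arrowComponents⁻ d ab∈d)

data ArrowPick : ∀ {k} → Profile k → Profile k → Profile k → Set where
  []  : ArrowPick [] [] []
  _∷_ : ∀ {k C a B} {Cs as Bs : Profile k} → a ⇒ B ∈ᶜ C → ArrowPick Cs as Bs → ArrowPick (C ∷ Cs) (a ∷ as) (B ∷ Bs)

arrowPicks : ∀ {k} → Profile k → List (Profile k × Profile k)
arrowPicks []       = ([] , []) ∷ []
arrowPicks (C ∷ Cs) =
  cartesianProductWith (λ (a , B) (as , Bs) → a ∷ as , B ∷ Bs) (arrowComponents C) (arrowPicks Cs)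

arrowPicks-sound : ∀ {k} (C : Profile k) {a B} → (a , B) ∈ arrowPicks C → ArrowPick C a B
arrowPicks-sound []       (here refl) = []
arrowPicks-sound (C ∷ Cs) aB∈ with ∈-cartesianProductWith⁻ _ (arrowComponents C) (arrowPicks Cs) aB∈
... | _ , _ , ⇒∈ , picks∈ , refl = ∈-arrowComponents⁻ C ⇒∈ ∷ arrowPicks-sound Cs picks∈

arrowPicks-complete : ∀ {k} {C a B : Profile k} → ArrowPick C a B → (a , B) ∈ arrowPicks C
arrowPicks-complete []            = here refl
arrowPicks-complete (⇒∈ ∷ picks) =
  ∈-cartesianProductWith⁺ _ (∈-arrowComponents⁺ ⇒∈) (arrowPicks-complete picks)

infix 4 _∋≈_ _∋≈?_

_∋≈_ : Ty → Ty → Set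
C ∋≈ t = ∃ λ c → c ∈ᶜ C × c ≈ t

_∋≈?_ : ∀ C t → Dec (C ∋≈ t)
tv i  ∋≈? t = map′ (λ ≈t → _ , self ni-tv , ≈t) (λ { (_ , self _ , ≈t) → ≈t }) (tv i ≈? t)
a ⇒ b ∋≈? t = map′ (λ ≈t → _ , self ni-⇒ , ≈t) (λ { (_ , self _ , ≈t) → ≈t }) (a ⇒ b ≈? t)
a ∩ b ∋≈? t = map′ (λ { (inj₁ (c , c∈ , ≈t)) → c , ∩ˡ c∈ , ≈t ; (inj₂ (c , c∈ , ≈t)) → c , ∩ʳ c∈ , ≈t })
                   (λ { (c , ∩ˡ c∈ , ≈t) → inj₁ (c , c∈ , ≈t) ; (c , ∩ʳ c∈ , ≈t) → inj₂ (c , c∈ , ≈t) })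
                   (a ∋≈? t ⊎-dec b ∋≈? t)

data Step {k} (W : State k → Bool) : State k → Set where
  lam  : ∀ {V t a b} → splitArrows t ≡ just (a , b) → T (W (a ∷ V , b , intro)) → Step W (V , t , intro)
  head : ∀ {V t p} → p ∈ V → T (W (V , t , elim p)) → Step W (V , t , intro)
  stop : ∀ {V t C} → Pointwise _∋≈_ C t → Step W (V , t , elim C)
  app  : ∀ {V t C a B} → ArrowPick C a B → T (W (V , a , intro)) → T (W (V , t , elim B)) →
         Step W (V , t , elim C)

module _ {k} (W : State k → Bool) where

  lam? : ∀ V t → Dec (∃₂ λ a b → splitArrows t ≡ just (a , b) × T (W (a ∷ V , b , intro)))
  lam? V t with splitArrows t
  ... | nothing      = no λ ()
  ... | just (a , b) = map′ (λ w → a , b , refl , w) (λ { (_ , _ , refl , w) → w }) (T? (W (a ∷ V , b , intro)))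

  head? : ∀ V t → Dec (∃ λ p → p ∈ V × T (W (V , t , elim p)))
  head? V t = map′ find (λ (_ , p∈ , w) → lose p∈ w) (any? (λ p → T? (W (V , t , elim p))) V)

  app? : ∀ V t C → Dec (∃₂ λ a B → ArrowPick C a B × T (W (V , a , intro)) × T (W (V , t , elim B)))
  app? V t C with any? (uncurry λ a B → T? (W (V , a , intro)) ×-dec T? (W (V , t , elim B))) (arrowPicks C)
  ... | yes found = let ((a , B) , aB∈ , wa , wB) = find found in yes (a , B , arrowPicks-sound C aB∈ , wa , wB)
  ... | no ¬found = no λ (_ , _ , pick , wa , wB) → ¬found (lose (arrowPicks-complete pick) (wa , wB))

  step? : ∀ s → Dec (Step W s)
  step? (V , t , intro)  = map′ [ (λ (_ , _ , eq , w) → lam eq w) , (λ (_ , p∈ , w) → head p∈ w) ]′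
                                (λ { (lam eq w) → inj₁ (_ , _ , eq , w) ; (head p∈ w) → inj₂ (_ , p∈ , w) })
                                (lam? V t ⊎-dec head? V t)
  step? (V , t , elim C) = map′ [ stop , (λ (_ , _ , pick , wa , wB) → app pick wa wB) ]′
                                (λ { (stop ≈s) → inj₁ ≈s ; (app pick wa wB) → inj₂ (_ , _ , pick , wa , wB) })
                                (Pointwise.decidable _∋≈?_ C t ⊎-dec app? V t C)

step : ∀ {k} → (State k → Bool) → State k → Bool
step W s = ⌊ step? W s ⌋

module Search {k : ℕ} = Iteration (step {k})
open Search using (MonotoneOn; _⇒[_]_; iterate-mono; _∼_; stabilise) renaming (iterate to search)

search⁻ : ∀ {k} i {s : State k} → T (search (suc i) s) → Step (search i) s
search⁻ i {s} = toWitness {a? = step? (search i) s}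

search⁺ : ∀ {k} i {s : State k} → Step (search i) s → T (search (suc i) s)
search⁺ i {s} = fromWitness {a? = step? (search i) s}

record Closed {k} (G : State k → Set) : Set where
  field
    closed-lam  : ∀ {V t a b} → G (V , t , intro) → splitArrows t ≡ just (a , b) → G (a ∷ V , b , intro)
    closed-head : ∀ {V t p} → G (V , t , intro) → p ∈ V → G (V , t , elim p)
    closed-arg  : ∀ {V t C a B} → G (V , t , elim C) → ArrowPick C a B → G (V , a , intro)
    closed-elim : ∀ {V t C a B} → G (V , t , elim C) → ArrowPick C a B → G (V , t , elim B)

step-mono : ∀ {k} {G : State k → Set} → Closed G → MonotoneOn G
step-mono {G = G} cl {W} {W′} W⇒W′ {s} g u = fromWitness {a? = step? W′ s} (Step-mono g (toWitness {a? = step? W s} u))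
  where
  open Closed cl
  Step-mono : ∀ {s} → G s → Step W s → Step W′ s
  Step-mono g (lam eq w)       = lam eq (W⇒W′ (closed-lam g eq) w)
  Step-mono g (head p∈ w)      = head p∈ (W⇒W′ (closed-head g p∈) w)
  Step-mono g (stop ≈s)        = stop ≈s
  Step-mono g (app pick wa wB) = app pick (W⇒W′ (closed-arg g pick) wa) (W⇒W′ (closed-elim g pick) wB)

step-mono-⊤ : ∀ {k} → MonotoneOn {k} (λ _ → ⊤)
step-mono-⊤ = step-mono (record { closed-lam = _ ; closed-head = _ ; closed-arg = _ ; closed-elim = _ })

search-mono : ∀ {k} {i j} → i ≤ j → search i ⇒[ (λ (_ : State k) → ⊤) ] search j
search-mono = iterate-mono step-mono-⊤

search-⊆ : ∀ {k} i {V V′ : List (Profile k)} {t m} → V ⊆ V′ → T (search i (V , t , m)) → T (search i (V′ , t , m))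
search-⊆ (suc i) {V} {V′} V⊆V′ u = search⁺ i (Step-⊆ (search⁻ i u))
  where
  Step-⊆ : ∀ {t m} → Step (search i) (V , t , m) → Step (search i) (V′ , t , m)
  Step-⊆ (lam eq w)       = lam eq (search-⊆ i (∷⁺ʳ _ V⊆V′) w)
  Step-⊆ (head p∈ w)      = head (V⊆V′ p∈) (search-⊆ i V⊆V′ w)
  Step-⊆ (stop ≈s)        = stop ≈s
  Step-⊆ (app pick wa wB) = app pick (search-⊆ i V⊆V′ wa) (search-⊆ i V⊆V′ wB)

infix 3 _⊢*_∶_
_⊢*_∶_ : ∀ {n k} → Vec (Env n) k → Tm n → Profile k → Set
Γs ⊢* M ∶ t = Pointwise (_⊢ M ∶_) Γs t

profile : ∀ {n k} → Vec (Env n) k → Fin n → Profile k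
profile Γs x = Vec.map (λ Γ → lookup Γ x) Γs

profiles : ∀ {n k} → Vec (Env n) k → List (Profile k)
profiles Γs = tabulate (profile Γs)

infixr 5 _∷*_
_∷*_ : ∀ {n k} → Profile k → Vec (Env n) k → Vec (Env (suc n)) k
_∷*_ = zipWith _∷_

profile-∷*-zero : ∀ {n k} (a : Profile k) (Γs : Vec (Env n) k) → profile (a ∷* Γs) zero ≡ a
profile-∷*-zero []      []       = refl
profile-∷*-zero (x ∷ a) (Γ ∷ Γs) = cong (x ∷_) (profile-∷*-zero a Γs)

profile-∷*-suc : ∀ {n k} (a : Profile k) (Γs : Vec (Env n) k) x → profile (a ∷* Γs) (suc x) ≡ profile Γs x
profile-∷*-suc []      []       x = refl
profile-∷*-suc (_ ∷ a) (Γ ∷ Γs) x = cong (lookup Γ x ∷_) (profile-∷*-suc a Γs x)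

profiles-∷* : ∀ {n k} (a : Profile k) (Γs : Vec (Env n) k) → profiles (a ∷* Γs) ≡ a ∷ profiles Γs
profiles-∷* a Γs = cong₂ _∷_ (profile-∷*-zero a Γs) (tabulate-cong (profile-∷*-suc a Γs))

⊢*-var : ∀ {n k} (Γs : Vec (Env n) k) x → Γs ⊢* var x ∶ profile Γs x
⊢*-var []       x = []
⊢*-var (Γ ∷ Γs) x = VAR x ∷ ⊢*-var Γs x

⊢*-lam : ∀ {n k} {Γs : Vec (Env n) k} (a b : Profile k) {P} → a ∷* Γs ⊢* P ∶ b → Γs ⊢* lam P ∶ zipWith _⇒_ a b
⊢*-lam {Γs = []}    []      []      []          = []
⊢*-lam {Γs = _ ∷ _} (_ ∷ a) (_ ∷ b) (⊢P ∷ ⊢Ps) = I⇒ ⊢P ∷ ⊢*-lam a b ⊢Ps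

⊢*-app : ∀ {n k} {Γs : Vec (Env n) k} {C a B M N} → ArrowPick C a B → Γs ⊢* M ∶ C → Γs ⊢* N ∶ a → Γs ⊢* app M N ∶ B
⊢*-app []             []          []          = []
⊢*-app (⇒∈ ∷ picks) (⊢M ∷ ⊢Ms) (⊢N ∷ ⊢Ns) = E⇒ (⊢-component ⇒∈ ⊢M) ⊢N ∷ ⊢*-app picks ⊢Ms ⊢Ns

⊢*-∋≈ : ∀ {n k} {Γs : Vec (Env n) k} {C t M} → Pointwise _∋≈_ C t → Γs ⊢* M ∶ C → Γs ⊢* M ∶ t
⊢*-∋≈ []                  []          = []
⊢*-∋≈ ((_ , c∈ , c≈) ∷ ≈s) (⊢M ∷ ⊢Ms) = ≈-ty (⊢-component c∈ ⊢M) c≈ ∷ ⊢*-∋≈ ≈s ⊢Ms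

mutual
  search-sound-intro : ∀ i {n k} (Γs : Vec (Env n) k) t →
                       T (search i (profiles Γs , t , intro)) → ∃ λ N → Γs ⊢* N ∶ t
  search-sound-intro (suc i) Γs t u with search⁻ i u
  ... | lam {a = a} {b} split≡ w
    with search-sound-intro i (a ∷* Γs) b (subst (λ V → T (search i (V , b , intro))) (sym (profiles-∷* a Γs)) w)
  ... | P , ⊢P = lam P , subst (Γs ⊢* lam P ∶_) (sym (splitArrows-sound t split≡)) (⊢*-lam a b ⊢P)
  search-sound-intro (suc i) Γs t u | head p∈ w with ∈-tabulate⁻ p∈
  ... | x , refl = search-sound-elim i Γs t (⊢*-var Γs x) w

  search-sound-elim : ∀ i {n k} (Γs : Vec (Env n) k) t {C M} → Γs ⊢* M ∶ C →
                      T (search i (profiles Γs , t , elim C)) → ∃ λ N → Γs ⊢* N ∶ t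
  search-sound-elim (suc i) Γs t ⊢M u with search⁻ i u
  ... | stop ≈s = _ , ⊢*-∋≈ ≈s ⊢M
  ... | app pick wa wB with search-sound-intro i Γs _ wa
  ... | N , ⊢N = search-sound-elim i Γs t (⊢*-app pick ⊢M ⊢N) wB

Rank≤ : ℕ → ∀ {m} → Vec Ty m → Set
Rank≤ r = All (λ A → rank A ≤ r)

All-profile : ∀ {n k} {P : Ty → Set} {Γs : Vec (Env n) k} → All (All P) Γs → ∀ x → All P (profile Γs x)
All-profile Ps x = map⁺ (All.map (λ P → lookup⁺ P x) Ps)

∷*-rank : ∀ {n k} {a : Profile k} {Γs : Vec (Env n) k} → Rank≤ 0 a → All (Rank≤ 1) Γs → All (Rank≤ 1) (a ∷* Γs)
∷*-rank []       []       = []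
∷*-rank (r ∷ rs) (e ∷ es) = (m≤n⇒m≤1+n r ∷ e) ∷ ∷*-rank rs es

zipWith-rank : ∀ {k} (a b : Profile k) → Rank≤ 0 (zipWith _⇒_ a b) → Rank≤ 0 a × Rank≤ 0 b
zipWith-rank []      []      []       = [] , []
zipWith-rank (x ∷ a) (y ∷ b) (r ∷ rs) with zipWith-rank a b rs
... | ra , rb = rank-dom x y (m≤n⇒m≤1+n r) ∷ ra , ≤-trans (rank-cod x y) r ∷ rb

ArrowPick-rank : ∀ {k} {C a B : Profile k} → Rank≤ 1 C → ArrowPick C a B → Rank≤ 0 a × Rank≤ 1 B
ArrowPick-rank []       []             = [] , []
ArrowPick-rank (r ∷ rs) (_∷_ {a = a} {B} ⇒∈ picks) with ArrowPick-rank rs picks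
... | ra , rB = rank-dom a B (≤-trans (rank-component ⇒∈) r) ∷ ra
              , ≤-trans (rank-cod a B) (≤-trans (rank-component ⇒∈) r) ∷ rB

⊢*-lam⁻ : ∀ {n k} {Γs : Vec (Env n) k} {t P} → All NonIntersection t → Γs ⊢* lam P ∶ t →
          ∃₂ λ a b → t ≡ zipWith _⇒_ a b × a ∷* Γs ⊢* P ∶ b
⊢*-lam⁻ []         []           = [] , [] , refl , []
⊢*-lam⁻ (ni ∷ nis) (⊢λ ∷ ⊢λs) with ⊢-lam⁻ ⊢λ (self ni) | ⊢*-lam⁻ nis ⊢λs
... | a , b , refl , ⊢P | as , bs , refl , ⊢Ps = a ∷ as , b ∷ bs , refl , ⊢P ∷ ⊢Ps

data Spines {n} (Ns : List (Tm n)) : ∀ {k} → Vec (Env n) k → Profile k → Profile k → Set where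
  []  : Spines Ns [] [] []
  _∷_ : ∀ {k Γ C t} {Γs : Vec (Env n) k} {Cs ts} →
        (∃₂ λ as c → C ⟨ as ⟩↝ c × c ≈ t × Pointwiseᴸ (Γ ⊢_∶_) Ns as) →
        Spines Ns Γs Cs ts → Spines Ns (Γ ∷ Γs) (C ∷ Cs) (t ∷ ts)

⊢*-var·*⁻ : ∀ {n k} {Γs : Vec (Env n) k} {t} x Ns → All NonIntersection t →
            Γs ⊢* var x ·* Ns ∶ t → Spines Ns Γs (profile Γs x) t
⊢*-var·*⁻ x Ns []         []         = []
⊢*-var·*⁻ x Ns (ni ∷ nis) (⊢ ∷ ⊢s) = ⊢-var·*⁻ ⊢ x Ns refl (self ni) ∷ ⊢*-var·*⁻ x Ns nis ⊢s

Spines-[]⁻ : ∀ {n k} {Γs : Vec (Env n) k} {C t} → Spines [] Γs C t → Pointwise _∋≈_ C t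
Spines-[]⁻ []                                 = []
Spines-[]⁻ ((_ , c , done c∈ , c≈ , []) ∷ sps) = (c , c∈ , c≈) ∷ Spines-[]⁻ sps

Spines-∷⁻ : ∀ {n k} {Γs : Vec (Env n) k} {N Ns C t} → Spines (N ∷ Ns) Γs C t →
            ∃₂ λ a B → ArrowPick C a B × Γs ⊢* N ∶ a × Spines Ns Γs B t
Spines-∷⁻ [] = [] , [] , [] , [] , []
Spines-∷⁻ ((_ , c , apply ⇒∈ ↝c , c≈ , ⊢N ∷ ⊢Ns) ∷ sps) with Spines-∷⁻ sps
... | as , Bs , picks , ⊢N* , sps′ = _ ∷ as , _ ∷ Bs , ⇒∈ ∷ picks , ⊢N ∷ ⊢N* , (_ , c , ↝c , c≈ , ⊢Ns) ∷ sps′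

mutual
  search-complete-intro : ∀ {n} {N : Tm n} → Nf N → ∀ {k} {Γs : Vec (Env n) k} {t} →
                          All (Rank≤ 1) Γs → Rank≤ 0 t → Γs ⊢* N ∶ t → ∃ λ i → T (search i (profiles Γs , t , intro))
  search-complete-intro (nf-lam nf) {Γs = Γs} r1 r0 ⊢λ with ⊢*-lam⁻ (All.map rank≤0⇒nonIntersection r0) ⊢λ
  ... | a , b , refl , ⊢P with zipWith-rank a b r0
  ... | ra , rb with search-complete-intro nf (∷*-rank ra r1) rb ⊢P
  ... | i , w = suc i , search⁺ i (lam (splitArrows-zipWith a b)
                                      (subst (λ V → T (search i (V , b , intro))) (profiles-∷* a Γs) w))
  search-complete-intro (nf-ne x {Ns} nfs) r1 r0 ⊢N =
    search-complete-head x Ns nfs r1 (All.map rank≤0⇒nonIntersection r0) ⊢N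

  search-complete-head : ∀ {n} x (Ns : List (Tm n)) → Allᴸ Nf Ns → ∀ {k} {Γs : Vec (Env n) k} {t} →
                         All (Rank≤ 1) Γs → All NonIntersection t → Γs ⊢* var x ·* Ns ∶ t →
                         ∃ λ i → T (search i (profiles Γs , t , intro))
  search-complete-head x Ns nfs r1 nis ⊢N with search-complete-elim nfs r1 (All-profile r1 x) (⊢*-var·*⁻ x Ns nis ⊢N)
  ... | i , w = suc i , search⁺ i (head (∈-tabulate⁺ x) w)

  search-complete-elim : ∀ {n} {Ns : List (Tm n)} → Allᴸ Nf Ns → ∀ {k} {Γs : Vec (Env n) k} {C t} →
                         All (Rank≤ 1) Γs → Rank≤ 1 C → Spines Ns Γs C t →
                         ∃ λ i → T (search i (profiles Γs , t , elim C))
  search-complete-elim []          r1 rC sps = 1 , search⁺ 0 (stop (Spines-[]⁻ sps))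
  search-complete-elim (nf ∷ nfs) r1 rC sps with Spines-∷⁻ sps
  ... | a , B , pick , ⊢N , sps′ with ArrowPick-rank rC pick
  ... | ra , rB with search-complete-intro nf r1 ra ⊢N | search-complete-elim nfs r1 rB sps′
  ... | i , wa | j , wB = suc (i ⊔ j) , search⁺ (i ⊔ j)
    (app pick (search-mono (m≤m⊔n i j) tt wa) (search-mono (m≤n⊔m i j) tt wB))

-- Finiteness of the search space

vectors : ∀ {A : Set} → List A → (k : ℕ) → List (Vec A k)
vectors xs zero    = [] ∷ []
vectors xs (suc k) = cartesianProductWith _∷_ xs (vectors xs k)

∈-vectors : ∀ {A : Set} {xs : List A} {k} {v : Vec A k} → All (_∈ xs) v → v ∈ vectors xs k
∈-vectors []         = here refl
∈-vectors (x∈ ∷ v∈) = ∈-cartesianProductWith⁺ _∷_ x∈ (∈-vectors v∈)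

sublists : ∀ {A : Set} → List A → List (List A)
sublists []       = [] ∷ []
sublists (x ∷ xs) = map (x ∷_) (sublists xs) ++ sublists xs

filter-∈-sublists : ∀ {A : Set} {P : A → Set} P? (xs : List A) → filter {P = P} P? xs ∈ sublists xs
filter-∈-sublists P? []       = here refl
filter-∈-sublists P? (x ∷ xs) with P? x
... | yes _ = ∈-++⁺ˡ (∈-map⁺ (x ∷_) (filter-∈-sublists P? xs))
... | no  _ = ∈-++⁺ʳ (map (x ∷_) (sublists xs)) (filter-∈-sublists P? xs)

module FiniteSearch (U : List Ty)
               (⇒-closed : ∀ {a b} → a ⇒ b ∈ U → a ∈ U × b ∈ U)
               (component-closed : ∀ {C c} → C ∈ U → c ∈ᶜ C → c ∈ U)
               {k : ℕ} where

  Over : Profile k → Set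
  Over = All (_∈ U)

  OverMode : Mode k → Set
  OverMode intro    = ⊤
  OverMode (elim C) = Over C

  Good : State k → Set
  Good (V , t , m) = Allᴸ Over V × Over t × OverMode m

  zipWith-Over⁻ : ∀ {j} (a b : Vec Ty j) → All (_∈ U) (zipWith _⇒_ a b) → All (_∈ U) a × All (_∈ U) b
  zipWith-Over⁻ []      []      []          = [] , []
  zipWith-Over⁻ (_ ∷ a) (_ ∷ b) (⇒∈ ∷ ⇒∈s) with ⇒-closed ⇒∈ | zipWith-Over⁻ a b ⇒∈s
  ... | x∈ , y∈ | a∈ , b∈ = x∈ ∷ a∈ , y∈ ∷ b∈

  ArrowPick-Over⁻ : ∀ {j} {C a B : Vec Ty j} → All (_∈ U) C → ArrowPick C a B → All (_∈ U) a × All (_∈ U) B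
  ArrowPick-Over⁻ []         []             = [] , []
  ArrowPick-Over⁻ (C∈ ∷ C∈s) (⇒∈ᶜ ∷ picks) with ⇒-closed (component-closed C∈ ⇒∈ᶜ) | ArrowPick-Over⁻ C∈s picks
  ... | a∈ , B∈ | as∈ , Bs∈ = a∈ ∷ as∈ , B∈ ∷ Bs∈

  closed-Good : Closed Good
  closed-Good = record
    { closed-lam  = λ { {t = t} {a} {b} (V∈ , t∈ , _) split≡ →
                        let a∈ , b∈ = zipWith-Over⁻ a b (subst Over (splitArrows-sound t split≡) t∈)
                        in a∈ ∷ V∈ , b∈ , tt }
    ; closed-head = λ { (V∈ , t∈ , _) p∈ → V∈ , t∈ , lookupᴸ V∈ p∈ }
    ; closed-arg  = λ { (V∈ , t∈ , C∈) pick → V∈ , proj₁ (ArrowPick-Over⁻ C∈ pick) , tt }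
    ; closed-elim = λ { (V∈ , t∈ , C∈) pick → V∈ , t∈ , proj₂ (ArrowPick-Over⁻ C∈ pick) }
    }

  profilesU : List (Profile k)
  profilesU = vectors U k

  modes : List (Mode k)
  modes = intro ∷ map elim profilesU

  states : List (State k)
  states = cartesianProductWith _,_ (sublists profilesU) (cartesianProductWith _,_ profilesU modes)

  open DecMembership (≡-dec {n = k} _≟ᵀ_) using (_∈?_)

  canonical : List (Profile k) → List (Profile k)
  canonical V = filter (_∈? V) profilesU

  -- search sees V only through membership (search-⊆), so V may be replaced by a sublist
  -- of profilesU.
  represent : ∀ {s} → Good s → ∃ λ s′ → s′ ∈ states × s ∼ s′
  represent {V , t , m} (V∈ , t∈ , m∈) =
    (canonical V , t , m) ,
    ∈-cartesianProductWith⁺ _,_ (filter-∈-sublists (_∈? V) profilesU)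
                                (∈-cartesianProductWith⁺ _,_ (∈-vectors t∈) (∈-modes m m∈)) ,
    λ i → mk⇔ (search-⊆ i V⊆canonical) (search-⊆ i (proj₂ ∘ ∈-filter⁻ (_∈? V) {xs = profilesU}))
    where
    ∈-modes : ∀ m → OverMode m → m ∈ modes
    ∈-modes intro    _  = here refl
    ∈-modes (elim C) C∈ = there (∈-map⁺ elim (∈-vectors C∈))

    V⊆canonical : V ⊆ canonical V
    V⊆canonical p∈ = ∈-filter⁺ (_∈? V) (∈-vectors (lookupᴸ V∈ p∈)) p∈

  search-bounded : ∀ {s} → Good s → ∀ i → T (search i s) → T (search (suc (length states)) s)
  search-bounded = stabilise states step-mono-⊤ (step-mono closed-Good) represent

-- The rank-2 λ-prefix

Task : ℕ → Set
Task n = Env n × Ty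

infix 4 _solves_
_solves_ : ∀ {n} → Tm n → List (Task n) → Set
N solves ts = ∀ {Γ A} → (Γ , A) ∈ ts → Γ ⊢ N ∶ A

componentTasks : ∀ {n} → Task n → List (Task n)
componentTasks (Γ , A) = map (Γ ,_) (components A)

split : ∀ {n} → List (Task n) → List (Task n)
split = concatMap componentTasks

∈-split⁺ : ∀ {n} {ts : List (Task n)} {Γ A c} → (Γ , A) ∈ ts → c ∈ᶜ A → (Γ , c) ∈ split ts
∈-split⁺ ΓA∈ c∈ = ∈-concatMap⁺ componentTasks (lose ΓA∈ (∈-map⁺ _ (∈-components⁺ c∈)))

∈-split⁻ : ∀ {n} (ts : List (Task n)) {Γ c} → (Γ , c) ∈ split ts → ∃ λ A → (Γ , A) ∈ ts × c ∈ᶜ A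
∈-split⁻ ts Γc∈ with find (∈-concatMap⁻ componentTasks {xs = ts} Γc∈)
... | (_ , A) , ΓA∈ , Γc∈′ with ∈-map⁻ _ Γc∈′
... | _ , c∈ , refl = A , ΓA∈ , ∈-components⁻ A c∈

solves-split⁺ : ∀ {n} {N : Tm n} ts → N solves split ts → N solves ts
solves-split⁺ ts ⊢split {A = A} ΓA∈ = ⊢-components A (λ c∈ → ⊢split (∈-split⁺ ΓA∈ c∈))

solves-split⁻ : ∀ {n} {N : Tm n} ts → N solves ts → N solves split ts
solves-split⁻ ts ⊢ts Γc∈ with ∈-split⁻ ts Γc∈
... | A , ΓA∈ , c∈ = ⊢-component c∈ (⊢ts ΓA∈)

unλ : ∀ {n} → List (Task n) → Maybe (List (Task (suc n)))
unλ []                 = just []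
unλ ((Γ , a ⇒ B) ∷ ts) = Maybe.map ((a ∷ Γ , B) ∷_) (unλ ts)
unλ ((_ , tv _) ∷ _)   = nothing
unλ ((_ , _ ∩ _) ∷ _)  = nothing

unλ-just : ∀ {n} (ts : List (Task n)) → (∀ {Γ c} → (Γ , c) ∈ ts → ∃₂ λ a B → c ≡ a ⇒ B) →
           ∃ λ ts′ → unλ ts ≡ just ts′
unλ-just []             arrows = [] , refl
unλ-just ((Γ , c) ∷ ts) arrows with arrows (here refl) | unλ-just ts (arrows ∘ there)
... | a , B , refl | ts′ , eq rewrite eq = _ , refl

∈-unλ⁺ : ∀ {n} (ts : List (Task n)) {ts′} → unλ ts ≡ just ts′ → ∀ {Γ c} → (Γ , c) ∈ ts →
         ∃₂ λ a B → c ≡ a ⇒ B × (a ∷ Γ , B) ∈ ts′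
∈-unλ⁺ ((Γ , a ⇒ B) ∷ ts) eq Γc∈ with unλ ts in eq′
∈-unλ⁺ ((Γ , a ⇒ B) ∷ ts) refl (here refl) | just _ = a , B , refl , here refl
∈-unλ⁺ ((Γ , a ⇒ B) ∷ ts) refl (there Γc∈) | just _ with ∈-unλ⁺ ts eq′ Γc∈
... | a′ , B′ , eq″ , ∈ts′ = a′ , B′ , eq″ , there ∈ts′

∈-unλ⁻ : ∀ {n} (ts : List (Task n)) {ts′} → unλ ts ≡ just ts′ → ∀ {Δ B} → (Δ , B) ∈ ts′ →
         ∃₂ λ Γ a → Δ ≡ a ∷ Γ × (Γ , a ⇒ B) ∈ ts
∈-unλ⁻ []                 refl ()
∈-unλ⁻ ((Γ , a ⇒ B) ∷ ts) eq ΔB∈ with unλ ts in eq′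
∈-unλ⁻ ((Γ , a ⇒ B) ∷ ts) refl (here refl) | just _ = Γ , a , refl , here refl
∈-unλ⁻ ((Γ , a ⇒ B) ∷ ts) refl (there ΔB∈) | just _ with ∈-unλ⁻ ts eq′ ΔB∈
... | Γ′ , a′ , eq″ , ∈ts = Γ′ , a′ , eq″ , there ∈ts

environments : ∀ {n} (ts : List (Task n)) → Vec (Env n) (length ts)
environments []             = []
environments ((Γ , _) ∷ ts) = Γ ∷ environments ts

targets : ∀ {n} (ts : List (Task n)) → Profile (length ts)
targets []             = []
targets ((_ , A) ∷ ts) = A ∷ targets ts

⊢*⇒solves : ∀ {n} {N : Tm n} ts → environments ts ⊢* N ∶ targets ts → N solves ts
⊢*⇒solves (_ ∷ ts) (⊢N ∷ _)   (here refl) = ⊢N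
⊢*⇒solves (_ ∷ ts) (_ ∷ ⊢Ns) (there ΓA∈) = ⊢*⇒solves ts ⊢Ns ΓA∈

solves⇒⊢* : ∀ {n} {N : Tm n} ts → N solves ts → environments ts ⊢* N ∶ targets ts
solves⇒⊢* []       ⊢ts = []
solves⇒⊢* (_ ∷ ts) ⊢ts = ⊢ts (here refl) ∷ solves⇒⊢* ts (⊢ts ∘ there)

All-environments : ∀ {n} {P : Env n → Set} ts → (∀ {Γ A} → (Γ , A) ∈ ts → P Γ) → All P (environments ts)
All-environments []       P∈ = []
All-environments (_ ∷ ts) P∈ = P∈ (here refl) ∷ All-environments ts (P∈ ∘ there)

All-targets : ∀ {n} {P : Ty → Set} (ts : List (Task n)) → (∀ {Γ A} → (Γ , A) ∈ ts → P A) → All P (targets ts)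
All-targets []       P∈ = []
All-targets (_ ∷ ts) P∈ = P∈ (here refl) ∷ All-targets ts (P∈ ∘ there)

lam-solves-split⇒arrows : ∀ {n} {P : Tm (suc n)} ts → lam P solves ts →
                          ∀ {Γ c} → (Γ , c) ∈ split ts → ∃₂ λ a B → c ≡ a ⇒ B
lam-solves-split⇒arrows ts ⊢ts Γc∈ with ∈-split⁻ ts Γc∈
... | _ , ΓA∈ , c∈ with ⊢-lam⁻ (⊢-component c∈ (⊢ts ΓA∈)) (self (∈ᶜ-nonIntersection c∈))
... | a , B , eq , _ = a , B , eq

module Rank2Search (U : List Ty)
             (⇒-closed : ∀ {a b} → a ⇒ b ∈ U → a ∈ U × b ∈ U)
             (component-closed : ∀ {C c} → C ∈ U → c ∈ᶜ C → c ∈ U) where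

  open FiniteSearch U ⇒-closed component-closed using (Good; states; search-bounded)

  bound : ℕ → ℕ
  bound k = suc (length (states {k}))

  headSearch : ∀ {n} → List (Task n) → Bool
  headSearch ts = search (bound (length (split ts))) (profiles (environments (split ts)) , targets (split ts) , intro)

  -- The fuel f bounds the size of the targets, hence the length of the λ-prefix.
  mutual
    solvable : ℕ → ∀ {n} → List (Task n) → Bool
    solvable f []         = true
    solvable f ts@(_ ∷ _) = headSearch ts ∨ lamSearch f ts

    lamSearch : ℕ → ∀ {n} → List (Task n) → Bool
    lamSearch zero    ts = false
    lamSearch (suc f) ts = maybe′ (solvable f) false (unλ (split ts))

  headSearch-sound : ∀ {n} (ts : List (Task n)) → T (headSearch ts) → ∃ λ N → N solves ts
  headSearch-sound ts u with search-sound-intro (bound (length (split ts))) (environments (split ts)) (targets (split ts)) u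
  ... | N , ⊢N = N , solves-split⁺ ts (⊢*⇒solves (split ts) ⊢N)

  mutual
    solvable-sound : ∀ f {n} (ts : List (Task n)) → T (solvable f ts) → ∃ λ N → N solves ts
    solvable-sound f []         _ = lam (var zero) , λ ()
    solvable-sound f ts@(_ ∷ _) u with headSearch ts | headSearch-sound ts
    ... | true  | sound = sound tt
    ... | false | _     = lamSearch-sound f ts u

    lamSearch-sound : ∀ f {n} (ts : List (Task n)) → T (lamSearch f ts) → ∃ λ N → N solves ts
    lamSearch-sound (suc f) ts u with unλ (split ts) in unλ≡
    ... | just ts′ with solvable-sound f ts′ u
    ... | P , ⊢P = lam P , solves-split⁺ ts ⊢lam
      where
      ⊢lam : lam P solves split ts
      ⊢lam Γc∈ with ∈-unλ⁺ (split ts) unλ≡ Γc∈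
      ... | _ , _ , refl , ∈ts′ = I⇒ (⊢P ∈ts′)

  record Admissible {n} (f : ℕ) (Γ : Env n) (A : Ty) : Set where
    field
      target-rank : rank A ≤ 2
      target-size : size A ≤ f
      target∈U    : A ∈ U
      env-rank    : Rank≤ 1 Γ
      env∈U       : All (_∈ U) Γ
  open Admissible

  AllAdmissible : ∀ {n} → ℕ → List (Task n) → Set
  AllAdmissible f ts = ∀ {Γ A} → (Γ , A) ∈ ts → Admissible f Γ A

  Admissible-body : ∀ {n f} {Γ : Env n} {A a B} → Admissible (suc f) Γ A → a ⇒ B ∈ᶜ A → Admissible f (a ∷ Γ) B
  Admissible-body {a = a} {B} adm ⇒∈ = record
    { target-rank = ≤-trans (rank-cod a B) rank⇒
    ; target-size = ≤-trans (m≤n+m (size B) (size a)) (s≤s⁻¹ (≤-trans (size-component ⇒∈) (target-size adm)))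
    ; target∈U    = proj₂ ⇒∈U
    ; env-rank    = rank-dom a B rank⇒ ∷ env-rank adm
    ; env∈U       = proj₁ ⇒∈U ∷ env∈U adm
    }
    where
    rank⇒ = ≤-trans (rank-component ⇒∈) (target-rank adm)
    ⇒∈U  = ⇒-closed (component-closed (target∈U adm) ⇒∈)

  split-good : ∀ {n f} (ts : List (Task n)) → AllAdmissible f ts →
               Good (profiles (environments (split ts)) , targets (split ts) , intro)
  split-good ts adm =
    tabulate⁺ (All-profile (All-environments (split ts) λ Γc∈ → env∈U (adm (proj₁ (proj₂ (∈-split⁻ ts Γc∈)))))) ,
    All-targets (split ts) (λ Γc∈ → let _ , ΓA∈ , c∈ = ∈-split⁻ ts Γc∈ in component-closed (target∈U (adm ΓA∈)) c∈) ,
    tt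

  headSearch-complete : ∀ {n f} x {Ns : List (Tm n)} → Allᴸ Nf Ns → ∀ ts →
                        var x ·* Ns solves ts → AllAdmissible f ts → T (headSearch ts)
  headSearch-complete x {Ns} nfs ts ⊢ts adm
    with search-complete-head x Ns nfs
           (All-environments (split ts) λ Γc∈ → env-rank (adm (proj₁ (proj₂ (∈-split⁻ ts Γc∈)))))
           (All-targets (split ts) λ Γc∈ → ∈ᶜ-nonIntersection (proj₂ (proj₂ (∈-split⁻ ts Γc∈))))
           (solves⇒⊢* (split ts) (solves-split⁻ ts ⊢ts))
  ... | i , w = search-bounded (split-good ts adm) i w

  mutual
    solvable-complete : ∀ f {n} {N : Tm n} → Nf N → ∀ ts → N solves ts → AllAdmissible f ts → T (solvable f ts)
    solvable-complete f nf            []           ⊢ts adm = tt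
    solvable-complete f (nf-lam nf)   ts@(t ∷ ts′) ⊢ts adm =
      Equivalence.from (T-∨ {headSearch ts} {lamSearch f ts}) (inj₂ (lamSearch-complete f nf t ts′ ⊢ts adm))
    solvable-complete f (nf-ne x nfs) ts@(_ ∷ _)   ⊢ts adm =
      Equivalence.from (T-∨ {headSearch ts} {lamSearch f ts}) (inj₁ (headSearch-complete x nfs ts ⊢ts adm))

    lamSearch-complete : ∀ f {n} {P : Tm (suc n)} → Nf P → ∀ t (ts : List (Task n)) →
                         lam P solves t ∷ ts → AllAdmissible f (t ∷ ts) → T (lamSearch f (t ∷ ts))
    lamSearch-complete zero nf (Γ , A) ts ⊢ts adm with ≤-trans (size-positive A) (target-size (adm (here refl)))
    ... | ()
    lamSearch-complete (suc f) {P = P} nf t ts ⊢ts adm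
      with unλ-just (split (t ∷ ts)) (lam-solves-split⇒arrows (t ∷ ts) ⊢ts)
    ... | ts′ , unλ≡ rewrite unλ≡ = solvable-complete f nf ts′ ⊢P adm′
      where
      ⊢P : P solves ts′
      ⊢P ΔB∈ with ∈-unλ⁻ (split (t ∷ ts)) unλ≡ ΔB∈
      ... | _ , _ , refl , Γ⇒∈ = ⊢-lam-⇒⁻ (solves-split⁻ (t ∷ ts) ⊢ts Γ⇒∈)

      adm′ : AllAdmissible f ts′
      adm′ ΔB∈ with ∈-unλ⁻ (split (t ∷ ts)) unλ≡ ΔB∈
      ... | _ , _ , refl , Γ⇒∈ with ∈-split⁻ (t ∷ ts) Γ⇒∈
      ... | _ , ΓA∈ , ⇒∈ = Admissible-body (adm ΓA∈) ⇒∈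

theorem10 : (τ : Ty) → rank τ ≤ 2 → Dec (Inhabited τ)
theorem10 τ rank≤2 = map′ sound complete (T? (solvable (size τ) (([] , τ) ∷ [])))
  where
  open Rank2Search (subterms τ) (subterms-⇒-closed τ) (subterms-component-closed τ)

  sound : T (solvable (size τ) (([] , τ) ∷ [])) → Inhabited τ
  sound u with solvable-sound (size τ) _ u
  ... | N , ⊢N = N , ⊢N (here refl)

  complete : Inhabited τ → T (solvable (size τ) (([] , τ) ∷ []))
  complete inhabited with normal-inhabitant inhabited
  ... | N , nf , ⊢N = solvable-complete (size τ) nf _ (λ { (here refl) → ⊢N }) λ { (here refl) → admissible }
    where
    admissible : Admissible (size τ) [] τ
    admissible = record { target-rank = rank≤2 ; target-size = ≤-refl ; target∈U = ∈-subterms-refl τ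
                        ; env-rank = [] ; env∈U = [] }
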